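{- Let $n,m$ be positive integers and $\mathbf a\in\mathbb N^n$. Then $$v^{(n,m)}(\mathbf a)=\sum_{\mathbf j\in\{0,1\}^n:\ \chi(\mathbf a)\trianglerighteq_1\mathbf j} v^{(n,m-1)}(\mathbf j).$$
   Context: $\chi(\mathbf a)\in\{0,1\}^n$ is the vector with the same support as $\mathbf a$; $\mathbf v\trianglerighteq\mathbf w$ means $\sum_{j\le i}v_j\ge\sum_{j\le i}w_j$ for all $i$. $z$-domination: for $\mathbf v,\mathbf w\in\mathbb N^n$ with $\mathbf v\trianglerighteq\mathbf w$ and $\chi(\mathbf v)\trianglerighteq\chi(\mathbf w)$, let $Z_{\mathbf v}=\{i:v_i=0\}$, $Z_{\mathbf w}=\{i:w_i=0\}$ and build a matching $M\subseteq Z_{\mathbf v}\times Z_{\mathbf w}$ by repeatedly taking the largest unmatched $i\in Z_{\mathbf v}$ and matching it to the largest unmatched $j\in Z_{\mathbf w}$ with $j\le i$, until all of $Z_{\mathbf v}$ is matched. Set $z=\max\{1,\max\{i-j:(i,j)\in M\}\}$ (with $z=1$ if $M=\emptyset$); then one writes $\mathbf v\trianglerighteq_z\mathbf w$. Thus $\mathbf v\trianglerighteq_1\mathbf w$ means $\mathbf v\trianglerighteq\mathbf w$, $\chi(\mathbf v)\trianglerighteq\chi(\mathbf w)$, and every pair $(i,j)\in M$ has $i-j\le1$. For positive $k$, $G(n,k)$ is the directed graph with vertices $\{(i,j):1\le i\le n,0\le j\le k\}\cup\{s\}$ and edges $((i,j),(i,j+1))$ ($1\le i\le n$, $0\le j\le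 k-1$), $((i,j),(i+1,j))$ ($1\le i\le n-1$, $0\le j\le k$), $((n,j),s)$ ($0\le j\le k$); $\mathcal F_{G(n,k)}(\mathbf a,\mathbf 0)$ is the polytope of $f:E\to\mathbb R_{\ge0}$ with outflow minus inflow equal to $a_i$ at $(i,0)$, $-\sum a_i$ at $s$, $0$ elsewhere. $v^{(n,k)}(\mathbf a)$ is the number of vertices of $\mathcal F_{G(n,k)}(\mathbf a,\mathbf 0)$, with the convention $v^{(n,0)}(\mathbf a)=1$ for all $\mathbf a$.
   Formalization: Flows in $\mathcal F_{G(n,k)}(\mathbf a,\mathbf 0)$ take values in ℚ rather than in the nonnegative reals, and its vertices are taken as extreme points among rational flows. -}

module Defs where

open import Data.Nat as ℕ using (ℕ; zero; suc; _∸_; _⊔_; _≤ᵇ_; _≡ᵇ_)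
open import Data.Bool using (Bool; true; false; _∧_; if_then_else_; T)
open import Data.Fin as Fin using (Fin; toℕ; inject₁; fromℕ)
open import Data.Fin.Properties as FinP using ()
open import Data.List as List using (List; []; _∷_; _++_; concatMap; foldr; length; reverse; zipWith; allFin)
open import Data.List.Relation.Unary.All using (All)
open import Data.List.Relation.Unary.Any using (Any)
open import Data.List.Relation.Unary.AllPairs using (AllPairs)
open import Data.Vec as Vec using (Vec; lookup; toList)
open import Data.Maybe as Maybe using (Maybe; just; nothing)
import Data.Maybe.Properties as MaybeP
import Data.Product.Properties as ProdP
open import Data.Product using (Σ; Σ-syntax; _×_; _,_)
open import Data.Integer as ℤ using (+_)
open import Data.Rational as ℚ using (ℚ; 0ℚ; 1ℚ; _+_; _*_; _-_; -_; _≤_; _<_)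
open import Relation.Binary.PropositionalEquality using (_≡_)
open import Relation.Nullary using (¬_; yes; no)

psums : List ℕ → List ℕ
psums = go 0
  where
  go : ℕ → List ℕ → List ℕ
  go acc []       = []
  go acc (x ∷ xs) = (acc ℕ.+ x) ∷ go (acc ℕ.+ x) xs

andL : List Bool → Bool
andL = foldr _∧_ true

dom : ∀ {n} → Vec ℕ n → Vec ℕ n → Bool
dom v w = andL (zipWith _≤ᵇ_ (psums (toList w)) (psums (toList v)))

χ : ∀ {n} → Vec ℕ n → Vec ℕ n
χ = Vec.map (λ { zero → 0 ; (suc _) → 1 })

zerosDesc : ∀ {n} → Vec ℕ n → List ℕ
zerosDesc v = reverse (go 1 (toList v))
  where
  go : ℕ → List ℕ → List ℕ
  go i []             = []
  go i (zero ∷ xs)    = i ∷ go (suc i) xs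
  go i (suc _ ∷ xs)   = go (suc i) xs

-- from a decreasingly sorted list of unmatched positions, take the
-- largest j with j ≤ i, returning it together with the remaining list
pick : ℕ → List ℕ → Maybe (ℕ × List ℕ)
pick i []       = nothing
pick i (j ∷ js) with j ≤ᵇ i
... | true  = just (j , js)
... | false = Maybe.map (λ { (j′ , r) → (j′ , j ∷ r) }) (pick i js)

greedy : List ℕ → List ℕ → Maybe (List (ℕ × ℕ))
greedy []       avail = just []
greedy (i ∷ is) avail with pick i avail
... | nothing          = nothing
... | just (j , rest)  = Maybe.map ((i , j) ∷_) (greedy is rest)

zOf : List (ℕ × ℕ) → ℕ
zOf M = 1 ⊔ foldr (λ { (i , j) acc → (i ∸ j) ⊔ acc }) 0 M

-- zdom v w = just z  iff  v ⊵_z w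
zdom : ∀ {n} → Vec ℕ n → Vec ℕ n → Maybe ℕ
zdom v w with dom v w ∧ dom (χ v) (χ w)
... | false = nothing
... | true  = Maybe.map zOf (greedy (zerosDesc v) (zerosDesc w))

dom₁ : ∀ {n} → Vec ℕ n → Vec ℕ n → Bool
dom₁ v w with zdom v w
... | nothing = false
... | just z  = z ≡ᵇ 1

binVecs : ∀ n → List (Vec ℕ n)
binVecs zero    = Vec.[] ∷ []
binVecs (suc n) = concatMap (λ v → (0 Vec.∷ v) ∷ (1 Vec.∷ v) ∷ []) (binVecs n)

filterᵇ : ∀ {A : Set} → (A → Bool) → List A → List A
filterᵇ p []       = []
filterᵇ p (x ∷ xs) = if p x then x ∷ filterᵇ p xs else filterᵇ p xs

sumℕ : List ℕ → ℕ
sumℕ = foldr ℕ._+_ 0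

-- The graph G(n,k), with n = suc n' (rows i ∈ Fin n, levels j ∈ Fin (k+1))

data Edge (n' k : ℕ) : Set where
  up     : Fin (suc n') → Fin k → Edge n' k
  right  : Fin n' → Fin (suc k) → Edge n' k
  toSink : Fin (suc k) → Edge n' k

-- vertices: just (i , j) is (i,j); nothing is the sink s
Node : ℕ → ℕ → Set
Node n' k = Maybe (Fin (suc n') × Fin (suc k))

tailE : ∀ {n' k} → Edge n' k → Node n' k
tailE (up i j)     = just (i , inject₁ j)
tailE (right i j)  = just (inject₁ i , j)
tailE {n'} (toSink j) = just (fromℕ n' , j)

headE : ∀ {n' k} → Edge n' k → Node n' k
headE (up i j)     = just (i , Fin.suc j)
headE (right i j)  = just (Fin.suc i , j)
headE (toSink j)   = nothing

allEdges : (n' k : ℕ) → List (Edge n' k)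
allEdges n' k =
     concatMap (λ i → List.map (up i) (allFin k)) (allFin (suc n'))
  ++ concatMap (λ i → List.map (right i) (allFin (suc k))) (allFin n')
  ++ List.map toSink (allFin (suc k))

_≟N_ : ∀ {n' k} (x y : Node n' k) → Relation.Nullary.Dec (x ≡ y)
_≟N_ = MaybeP.≡-dec (ProdP.≡-dec FinP._≟_ FinP._≟_)

δ : ∀ {n' k} → Node n' k → Node n' k → ℚ
δ x y with x ≟N y
... | yes _ = 1ℚ
... | no  _ = 0ℚ

sumℚ : List ℚ → ℚ
sumℚ = foldr _+_ 0ℚ

ℕ→ℚ : ℕ → ℚ
ℕ→ℚ m = (+ m) ℚ./ 1

-- outflow minus inflow of f at vertex x
netFlow : ∀ {n' k} → (Edge n' k → ℚ) → Node n' k → ℚ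
netFlow {n'} {k} f x =
  sumℚ (List.map (λ e → f e * (δ (tailE e) x - δ (headE e) x)) (allEdges n' k))

demand : ∀ {n' k} → Vec ℕ (suc n') → Node n' k → ℚ
demand a nothing               = - ℕ→ℚ (sumℕ (toList a))
demand a (just (i , Fin.zero)) = ℕ→ℚ (lookup a i)
demand a (just (i , Fin.suc _)) = 0ℚ

-- f ∈ F_{G(n,k)}(a, 0)   (rational points; the polytope is rational)
InFlowPolytope : (n' k : ℕ) → Vec ℕ (suc n') → (Edge n' k → ℚ) → Set
InFlowPolytope n' k a f =
  (∀ e → 0ℚ ≤ f e) × (∀ x → netFlow f x ≡ demand a x)

IsVertex : (n' k : ℕ) → Vec ℕ (suc n') → (Edge n' k → ℚ) → Set
IsVertex n' k a f =
  InFlowPolytope n' k a f ×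
  (∀ (λ′ : ℚ) (g h : Edge n' k → ℚ) → 0ℚ < λ′ → λ′ < 1ℚ →
     InFlowPolytope n' k a g → InFlowPolytope n' k a h →
     (∀ e → f e ≡ λ′ * g e + (1ℚ - λ′) * h e) →
     (∀ e → g e ≡ f e) × (∀ e → h e ≡ f e))

_≐_ : ∀ {n' k} → (Edge n' k → ℚ) → (Edge n' k → ℚ) → Set
f ≐ g = ∀ e → f e ≡ g e

HasVertexCount : (n' k : ℕ) → Vec ℕ (suc n') → ℕ → Set
HasVertexCount n' k a N =
  Σ[ L ∈ List (Edge n' k → ℚ) ]
    All (IsVertex n' k a) L ×
    AllPairs (λ f g → ¬ (f ≐ g)) L ×
    (∀ f → IsVertex n' k a f → Any (λ g → f ≐ g) L) ×
    length L ≡ N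

-- v^{(n,k)}(a) = N, with the convention v^{(n,0)}(a) = 1
VertexNumber : (n' k : ℕ) → Vec ℕ (suc n') → ℕ → Set
VertexNumber n' zero    a N = N ≡ 1
VertexNumber n' (suc k) a N = HasVertexCount n' (suc k) a N

-- A flow on G(n,k) is a stack of levels.  On the bottom level column i receives a_i
-- plus whatever arrives from its left and sends it upwards or onwards; what rises is
-- the demand of the levels above.  A flow is a vertex exactly when no node sends flow
-- both upwards and onwards: otherwise shifting ±ε between the two directions,
-- absorbing the change downstream and rebuilding the levels above exhibits it as a
-- midpoint.  So a vertex is a plan: the 0/1 vector j of columns sending their flow up
-- at the bottom, followed by a vertex of the levels above for the rising demand, whose
-- support is j.  Such a j is realisable from a demand with support b iff every column
-- with j = 1 receives positive flow, and for 0/1 vectors this is exactly b ⊵₁ j.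
-- Counting plans level by level gives the recursion.

module Submission where

open import Defs
open import Data.Nat as ℕ using (ℕ; zero; suc; z≤n; s≤s)
import Data.Nat.Properties as ℕ
open import Data.Bool using (Bool; true; false; _∧_; _∨_; T; if_then_else_)
import Data.Bool.Properties as Bool
open import Data.Empty using (⊥; ⊥-elim)
open import Data.Fin as Fin using (Fin; zero; suc; inject₁; fromℕ)
import Data.Fin.Properties as Fin
open import Data.List as List
  using (List; []; _∷_; _++_; concatMap; allFin; tabulate; length; reverse; drop; map)
import Data.List.Properties as List
open import Data.List.Membership.Propositional using (_∈_; find)
open import Data.List.Membership.Propositional.Properties
  using (∈-concatMap⁺; ∈-concatMap⁻; ∈-filter⁺; ∈-filter⁻; ∈-map⁺; ∈-map⁻)
open import Data.List.Relation.Unary.All as All using (All; []; _∷_)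
import Data.List.Relation.Unary.All.Properties as All
open import Data.List.Relation.Unary.AllPairs as AllPairs using (AllPairs; []; _∷_)
import Data.List.Relation.Unary.AllPairs.Properties as AllPairs
open import Data.List.Relation.Unary.Any as Any using (Any; here; there)
import Data.List.Relation.Unary.Any.Properties as Any
open import Data.List.Relation.Unary.Unique.Propositional using (Unique)
import Data.List.Relation.Unary.Unique.Propositional.Properties as Unique
open import Data.Maybe as Maybe using (Maybe; just; nothing)
open import Data.Product using (Σ-syntax; _×_; _,_; proj₁; proj₂)
open import Data.Sum using (_⊎_; inj₁; inj₂)
open import Data.Unit using (⊤; tt)
open import Data.Vec as Vec using (Vec; []; _∷_; lookup; toList; replicate)
import Data.Vec.Properties as Vec
import Data.Vec.Relation.Unary.All as AllV
import Data.Vec.Relation.Unary.All.Properties as AllV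
open import Data.Vec.Functional using (Vector) renaming (_∷_ to _◃_)
open import Function using (_∘_; _⇔_; mk⇔; Equivalence)
open import Relation.Binary.PropositionalEquality
open import Relation.Nullary using (Dec; does; yes; no; ¬_)
open import Relation.Nullary.Decidable using (T?; dec-true; dec-false)

private variable
  A B : Set
  m n' : ℕ

-- The relation ⊵₁ on 0/1 vectors

-- ℕ arithmetic is opened only in this block: ℚ's operators are used unqualified below.
module _ where

  open import Data.Nat using (_+_; _∸_; _⊔_; _≤ᵇ_; _≡ᵇ_; _≤_; _<_)

  isPos : ℕ → Bool
  isPos zero    = false
  isPos (suc _) = true

  bit : Bool → ℕ
  bit true  = 1
  bit false = 0

  isPos-bit : ∀ b → isPos (bit b) ≡ b
  isPos-bit true  = refl
  isPos-bit false = refl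

  Binary : Vec ℕ m → Set
  Binary = AllV.All (_≤ 1)

  binary-χ : (a : Vec ℕ m) → Binary (χ a)
  binary-χ []            = AllV.[]
  binary-χ (zero ∷ a)    = z≤n AllV.∷ binary-χ a
  binary-χ (suc _ ∷ a)   = s≤s z≤n AllV.∷ binary-χ a

  -- Reading columns left to right, carry records whether positive flow arrives from the
  -- left; a column with j ≥ 1 sends everything up, so it needs positive flow and passes
  -- nothing on.
  routable : Bool → Vec ℕ m → Vec ℕ m → Bool
  routable carry []      []          = true
  routable carry (x ∷ b) (zero ∷ j)  = routable (carry ∨ isPos x) b j
  routable carry (x ∷ b) (suc _ ∷ j) = (carry ∨ isPos x) ∧ routable false b j

  zeroPositions : ℕ → List ℕ → List ℕ
  zeroPositions i []           = []
  zeroPositions i (zero ∷ xs)  = i ∷ zeroPositions (suc i) xs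
  zeroPositions i (suc _ ∷ xs) = zeroPositions (suc i) xs

  private
    zeroPositions-unique : (F : ℕ → List ℕ → List ℕ) → (∀ i → F i [] ≡ []) →
      (∀ i xs → F i (zero ∷ xs) ≡ i ∷ F (suc i) xs) →
      (∀ i x xs → F i (suc x ∷ xs) ≡ F (suc i) xs) →
      ∀ i xs → F i xs ≡ zeroPositions i xs
    zeroPositions-unique F nil z s i []           = nil i
    zeroPositions-unique F nil z s i (zero ∷ xs)  =
      trans (z i xs) (cong (i ∷_) (zeroPositions-unique F nil z s (suc i) xs))
    zeroPositions-unique F nil z s i (suc x ∷ xs) =
      trans (s i x xs) (zeroPositions-unique F nil z s (suc i) xs)

  -- zerosDesc is computed by a helper local to its definition; once the literal 1 is
  -- generalised, unification identifies that helper with zeroPositions.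
  zerosDesc≡ : (v : Vec ℕ m) → zerosDesc v ≡ reverse (zeroPositions 1 (toList v))
  zerosDesc≡ v =
    generalised (zeroPositions-unique helper (λ _ → refl) (λ _ _ → refl) (λ _ _ _ → refl))
    where
    helper : ℕ → List ℕ → List ℕ
    helper = _
    generalised : (∀ i xs → helper i xs ≡ zeroPositions i xs) →
                  zerosDesc v ≡ reverse (zeroPositions 1 (toList v))
    generalised eq with toList v | 1 | reverse {A = ℕ}
    ... | xs | i | rev = cong rev (eq i xs)

  -- zerosFromRight (reverse xs) lists the 1-based positions of the zeros of xs, largest first.
  zerosFromRight : List ℕ → List ℕ
  zerosFromRight []           = []
  zerosFromRight (zero ∷ r)   = suc (length r) ∷ zerosFromRight r
  zerosFromRight (suc _ ∷ r)  = zerosFromRight r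

  private
    ifZero : ℕ → ℕ → List ℕ
    ifZero p zero    = p ∷ []
    ifZero p (suc _) = []

    zeroPositions-∷ʳ : ∀ i xs x →
      zeroPositions i (xs ++ x ∷ []) ≡ zeroPositions i xs ++ ifZero (i + length xs) x
    zeroPositions-∷ʳ i [] zero    = cong (_∷ []) (sym (ℕ.+-identityʳ i))
    zeroPositions-∷ʳ i [] (suc x) = refl
    zeroPositions-∷ʳ i (y ∷ xs) x =
      trans (step y) (cong (λ p → zeroPositions i (y ∷ xs) ++ ifZero p x) (sym (ℕ.+-suc i (length xs))))
      where
      step : ∀ y →
        zeroPositions i (y ∷ xs ++ x ∷ []) ≡ zeroPositions i (y ∷ xs) ++ ifZero (suc i + length xs) x
      step zero    = cong (i ∷_) (zeroPositions-∷ʳ (suc i) xs x)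
      step (suc _) = zeroPositions-∷ʳ (suc i) xs x

    reverse-ifZero : ∀ p x → reverse (ifZero p x) ≡ ifZero p x
    reverse-ifZero p zero    = refl
    reverse-ifZero p (suc _) = refl

    zerosFromRight-∷ : ∀ x r → zerosFromRight (x ∷ r) ≡ ifZero (suc (length r)) x ++ zerosFromRight r
    zerosFromRight-∷ zero    r = refl
    zerosFromRight-∷ (suc _) r = refl

    reverse-zeroPositions : ∀ r → reverse (zeroPositions 1 (reverse r)) ≡ zerosFromRight r
    reverse-zeroPositions []      = refl
    reverse-zeroPositions (x ∷ r) = begin
      reverse (zeroPositions 1 (reverse (x ∷ r)))
        ≡⟨ cong (reverse ∘ zeroPositions 1) (List.unfold-reverse x r) ⟩
      reverse (zeroPositions 1 (reverse r ++ x ∷ []))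
        ≡⟨ cong reverse (zeroPositions-∷ʳ 1 (reverse r) x) ⟩
      reverse (zeroPositions 1 (reverse r) ++ ifZero (suc (length (reverse r))) x)
        ≡⟨ List.reverse-++ (zeroPositions 1 (reverse r)) _ ⟩
      reverse (ifZero (suc (length (reverse r))) x) ++ reverse (zeroPositions 1 (reverse r))
        ≡⟨ cong₂ _++_
             (trans (reverse-ifZero _ x) (cong (λ n → ifZero (suc n) x) (List.length-reverse r)))
             (reverse-zeroPositions r) ⟩
      ifZero (suc (length r)) x ++ zerosFromRight r
        ≡⟨ zerosFromRight-∷ x r ⟨
      zerosFromRight (x ∷ r) ∎
      where open ≡-Reasoning

  zerosDesc≡zerosFromRight : (v : Vec ℕ m) → zerosDesc v ≡ zerosFromRight (reverse (toList v))
  zerosDesc≡zerosFromRight v = begin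
    zerosDesc v
      ≡⟨ zerosDesc≡ v ⟩
    reverse (zeroPositions 1 (toList v))
      ≡⟨ cong (reverse ∘ zeroPositions 1) (List.reverse-involutive (toList v)) ⟨
    reverse (zeroPositions 1 (reverse (reverse (toList v))))
      ≡⟨ reverse-zeroPositions (reverse (toList v)) ⟩
    zerosFromRight (reverse (toList v)) ∎
    where open ≡-Reasoning

  zerosFromRight-< : ∀ r → All (_< suc (length r)) (zerosFromRight r)
  zerosFromRight-< []          = []
  zerosFromRight-< (zero ∷ r)  = ℕ.≤-refl ∷ All.map ℕ.m≤n⇒m≤1+n (zerosFromRight-< r)
  zerosFromRight-< (suc _ ∷ r) = All.map ℕ.m≤n⇒m≤1+n (zerosFromRight-< r)

  psumsFrom : ℕ → List ℕ → List ℕ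
  psumsFrom s []       = []
  psumsFrom s (x ∷ xs) = (s + x) ∷ psumsFrom (s + x) xs

  -- psums is also computed by a local helper, which at accumulator s is drop 1 ∘ psums ∘ (s ∷_).
  psums≡psumsFrom : ∀ xs → psums xs ≡ psumsFrom 0 xs
  psums≡psumsFrom = from 0
    where
    from : ∀ s xs → drop 1 (psums (s ∷ xs)) ≡ psumsFrom s xs
    from s []       = refl
    from s (x ∷ xs) = cong ((s + x) ∷_) (from (s + x) xs)

  allWithin1 : List (ℕ × ℕ) → Bool
  allWithin1 []            = true
  allWithin1 ((i , p) ∷ M) = (i ∸ p ≤ᵇ 1) ∧ allWithin1 M

  matchedWithin1 : Maybe (List (ℕ × ℕ)) → Bool
  matchedWithin1 nothing  = false
  matchedWithin1 (just M) = allWithin1 M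

  matchedWithin1-∷ : ∀ i p X →
    matchedWithin1 (Maybe.map ((i , p) ∷_) X) ≡ (i ∸ p ≤ᵇ 1) ∧ matchedWithin1 X
  matchedWithin1-∷ i p nothing  = sym (Bool.∧-zeroʳ _)
  matchedWithin1-∷ i p (just M) = refl

  private
    pick-head : ∀ i p ps → p ≤ i → pick i (p ∷ ps) ≡ just (p , ps)
    pick-head i p ps p≤i with p ≤ᵇ i | ℕ.≤⇒≤ᵇ p≤i
    ... | true | _ = refl

    pick-skip-nothing : ∀ i p ps → i < p → pick i ps ≡ nothing → pick i (p ∷ ps) ≡ nothing
    pick-skip-nothing i p ps i<p eq with p ≤ᵇ i | ℕ.≤ᵇ⇒≤ p i
    ... | false | _   rewrite eq = refl
    ... | true  | p≤i = ⊥-elim (ℕ.<⇒≱ i<p (p≤i tt))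

    pick-skip-just : ∀ i p ps {q r} → i < p → pick i ps ≡ just (q , r) →
                     pick i (p ∷ ps) ≡ just (q , p ∷ r)
    pick-skip-just i p ps i<p eq with p ≤ᵇ i | ℕ.≤ᵇ⇒≤ p i
    ... | false | _   rewrite eq = refl
    ... | true  | p≤i = ⊥-elim (ℕ.<⇒≱ i<p (p≤i tt))

    greedy-nothing : ∀ i is A → pick i A ≡ nothing → greedy (i ∷ is) A ≡ nothing
    greedy-nothing i is A eq with pick i A
    ... | nothing = refl

    greedy-just : ∀ i is A {p r} → pick i A ≡ just (p , r) →
                  greedy (i ∷ is) A ≡ Maybe.map ((i , p) ∷_) (greedy is r)
    greedy-just i is A eq with pick i A
    ... | just _ with refl ← eq = refl

    greedy-skip : ∀ {p} is A → All (_< p) is → greedy is (p ∷ A) ≡ greedy is A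
    greedy-skip     []       A []           = refl
    greedy-skip {p} (i ∷ is) A (i<p ∷ is<p) with pick i A in eq
    ... | nothing      = greedy-nothing i is (p ∷ A) (pick-skip-nothing i p A i<p eq)
    ... | just (q , r) = trans (greedy-just i is (p ∷ A) (pick-skip-just i p A i<p eq))
                               (cong (Maybe.map ((i , q) ∷_)) (greedy-skip is r is<p))

  -- States of a right-to-left scan matching the zeros of b to those of j: the current
  -- position is free, or already claimed by a zero of b just to its right, or matching failed.
  data Scan : Set where
    free claimed stuck : Scan

  step : Scan → ℕ → ℕ → Scan
  step free    (suc _) _       = free
  step free    zero    zero    = free
  step free    zero    (suc _) = claimed
  step claimed _       (suc _) = stuck
  step claimed (suc _) zero    = free
  step claimed zero    zero    = claimed
  step stuck   _       _       = stuck

  run : Scan → List ℕ → List ℕ → Scan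
  run s (x ∷ xs) (y ∷ ys) = run (step s x y) xs ys
  run s _        _        = s

  accepts : Scan → Bool
  accepts free    = true
  accepts claimed = false
  accepts stuck   = false

  run-stuck : ∀ xs ys → run stuck xs ys ≡ stuck
  run-stuck []       ys       = refl
  run-stuck (x ∷ xs) []       = refl
  run-stuck (x ∷ xs) (y ∷ ys) = run-stuck xs ys

  private
    available : Scan → List ℕ → List ℕ
    available free    r       = zerosFromRight r
    available claimed []      = []
    available claimed (_ ∷ r) = zerosFromRight r
    available stuck   _       = []

    Consistent : Scan → List ℕ → Set
    Consistent free    _          = ⊤
    Consistent claimed (zero ∷ _) = ⊤
    Consistent claimed _          = ⊥
    Consistent stuck   _          = ⊥

    gap-0 : ∀ {n n′} → n ≡ n′ → (suc n ∸ suc n′ ≤ᵇ 1) ≡ true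
    gap-0 {n} refl = cong (_≤ᵇ 1) (ℕ.n∸n≡0 n)

    gap-1 : ∀ {n n′} → n ≡ n′ → (suc (suc n) ∸ suc n′ ≤ᵇ 1) ≡ true
    gap-1 {zero}  refl = refl
    gap-1 {suc n} refl = gap-1 {n} refl

    gap-2 : ∀ {n q} → q ≤ n → (suc (suc n) ∸ q ≤ᵇ 1) ≡ false
    gap-2 {n}     {zero}  _         = refl
    gap-2 {suc n} {suc q} (s≤s q≤n) = gap-2 q≤n

    matchedWithin1-head : ∀ i is p ps → p ≤ i →
      matchedWithin1 (greedy (i ∷ is) (p ∷ ps)) ≡ (i ∸ p ≤ᵇ 1) ∧ matchedWithin1 (greedy is ps)
    matchedWithin1-head i is p ps p≤i =
      trans (cong matchedWithin1 (greedy-just i is (p ∷ ps) (pick-head i p ps p≤i)))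
            (matchedWithin1-∷ i p (greedy is ps))

    mutual
      greedy-accepts : ∀ s rb rj → length rb ≡ length rj → Consistent s rj →
        matchedWithin1 (greedy (zerosFromRight rb) (available s rj)) ≡ accepts (run s rb rj)
      greedy-accepts free    []           []           _ _ = refl
      greedy-accepts free    (suc _ ∷ rb) (zero ∷ rj)  e _ =
        trans (cong matchedWithin1 (greedy-skip (zerosFromRight rb) (zerosFromRight rj) below))
              (greedy-accepts free rb rj (ℕ.suc-injective e) _)
        where
        below : All (_< suc (length rj)) (zerosFromRight rb)
        below = subst (λ n → All (_< suc n) (zerosFromRight rb)) (ℕ.suc-injective e) (zerosFromRight-< rb)
      greedy-accepts free    (suc _ ∷ rb) (suc _ ∷ rj) e _ =
        greedy-accepts free rb rj (ℕ.suc-injective e) _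
      greedy-accepts free    (zero ∷ rb)  (zero ∷ rj)  e _ =
        trans (matchedWithin1-head (suc (length rb)) (zerosFromRight rb) (suc (length rj)) (zerosFromRight rj)
                 (ℕ.≤-reflexive (sym e)))
              (cong₂ _∧_ (gap-0 (ℕ.suc-injective e)) (greedy-accepts free rb rj (ℕ.suc-injective e) _))
      greedy-accepts free    (zero ∷ rb)  (suc _ ∷ rj) e _ = claim rb rj (ℕ.suc-injective e)
      greedy-accepts claimed (suc _ ∷ rb) (zero ∷ rj)  e _ =
        greedy-accepts free rb rj (ℕ.suc-injective e) _
      greedy-accepts claimed (zero ∷ rb)  (zero ∷ rj)  e _ = claim rb rj (ℕ.suc-injective e)

      claim : ∀ rb rj → length rb ≡ length rj →
        matchedWithin1 (greedy (suc (length rb) ∷ zerosFromRight rb) (zerosFromRight rj)) ≡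
        accepts (run claimed rb rj)
      claim []       []           _ = refl
      claim (x ∷ rb) (zero ∷ rj)  e =
        trans (matchedWithin1-head (suc (length (x ∷ rb))) (zerosFromRight (x ∷ rb))
                 (suc (length rj)) (zerosFromRight rj) (ℕ.m≤n⇒m≤1+n (ℕ.≤-reflexive (sym e))))
              (cong₂ _∧_ (gap-1 (ℕ.suc-injective e))
                         (greedy-accepts claimed (x ∷ rb) (zero ∷ rj) e _))
      claim (x ∷ rb) (suc _ ∷ rj) e =
        trans (too-far (zerosFromRight rj) (zerosFromRight-< rj)) (sym (cong accepts (run-stuck rb rj)))
        where
        too-far : ∀ A → All (_< suc (length rj)) A →
                  matchedWithin1 (greedy (suc (length (x ∷ rb)) ∷ zerosFromRight (x ∷ rb)) A) ≡ false
        too-far []      _         = refl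
        too-far (q ∷ A) (q<l ∷ _) =
          trans (matchedWithin1-head _ (zerosFromRight (x ∷ rb)) q A
                   (ℕ.m≤n⇒m≤1+n (ℕ.m≤n⇒m≤1+n q≤l)))
                (cong (_∧ matchedWithin1 (greedy (zerosFromRight (x ∷ rb)) A)) (gap-2 q≤l))
          where
          q≤l : q ≤ length rb
          q≤l = subst (q ≤_) (sym (ℕ.suc-injective e)) (ℕ.≤-pred q<l)

  -- Whether a scan of a suffix ending in state s is compatible with a carry of positive flow
  -- arriving from the left of that suffix: a carry settles a pending claim.
  acceptable : Bool → Scan → Bool
  acceptable false s       = accepts s
  acceptable true  free    = true
  acceptable true  claimed = true
  acceptable true  stuck   = false

  private
    acceptable-step-0 : ∀ carry x s → acceptable (carry ∨ isPos x) s ≡ acceptable carry (step s x zero)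
    acceptable-step-0 false zero    free    = refl
    acceptable-step-0 false zero    claimed = refl
    acceptable-step-0 false zero    stuck   = refl
    acceptable-step-0 false (suc _) free    = refl
    acceptable-step-0 false (suc _) claimed = refl
    acceptable-step-0 false (suc _) stuck   = refl
    acceptable-step-0 true  zero    free    = refl
    acceptable-step-0 true  zero    claimed = refl
    acceptable-step-0 true  zero    stuck   = refl
    acceptable-step-0 true  (suc _) free    = refl
    acceptable-step-0 true  (suc _) claimed = refl
    acceptable-step-0 true  (suc _) stuck   = refl

    acceptable-step-1 : ∀ carry x y s →
      (carry ∨ isPos x) ∧ accepts s ≡ acceptable carry (step s x (suc y))
    acceptable-step-1 false zero    y free    = refl
    acceptable-step-1 false zero    y claimed = refl
    acceptable-step-1 false zero    y stuck   = refl
    acceptable-step-1 false (suc _) y free    = refl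
    acceptable-step-1 false (suc _) y claimed = refl
    acceptable-step-1 false (suc _) y stuck   = refl
    acceptable-step-1 true  zero    y free    = refl
    acceptable-step-1 true  zero    y claimed = refl
    acceptable-step-1 true  zero    y stuck   = refl
    acceptable-step-1 true  (suc _) y free    = refl
    acceptable-step-1 true  (suc _) y claimed = refl
    acceptable-step-1 true  (suc _) y stuck   = refl

    run-∷ʳ : ∀ s xs ys x y → length xs ≡ length ys →
             run s (xs ++ x ∷ []) (ys ++ y ∷ []) ≡ step (run s xs ys) x y
    run-∷ʳ s []       []       x y _ = refl
    run-∷ʳ s (a ∷ xs) (b ∷ ys) x y e = run-∷ʳ (step s a b) xs ys x y (ℕ.suc-injective e)

  scanFromRight : Vec ℕ m → Vec ℕ m → Scan
  scanFromRight b j = run free (reverse (toList b)) (reverse (toList j))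

  length-reverse-toList : (v : Vec ℕ m) → length (reverse (toList v)) ≡ m
  length-reverse-toList v = trans (List.length-reverse (toList v)) (Vec.length-toList v)

  scanFromRight-∷ : ∀ x y (b j : Vec ℕ m) →
    scanFromRight (x ∷ b) (y ∷ j) ≡ step (scanFromRight b j) x y
  scanFromRight-∷ x y b j = trans
    (cong₂ (run free) (List.unfold-reverse x (toList b)) (List.unfold-reverse y (toList j)))
    (run-∷ʳ free (reverse (toList b)) (reverse (toList j)) x y
      (trans (length-reverse-toList b) (sym (length-reverse-toList j))))

  routable≡acceptable : ∀ (b j : Vec ℕ m) carry →
    routable carry b j ≡ acceptable carry (scanFromRight b j)
  routable≡acceptable [] [] false = refl
  routable≡acceptable [] [] true  = refl
  routable≡acceptable (x ∷ b) (zero ∷ j) carry = begin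
    routable (carry ∨ isPos x) b j
      ≡⟨ routable≡acceptable b j (carry ∨ isPos x) ⟩
    acceptable (carry ∨ isPos x) (scanFromRight b j)
      ≡⟨ acceptable-step-0 carry x _ ⟩
    acceptable carry (step (scanFromRight b j) x 0)
      ≡⟨ cong (acceptable carry) (scanFromRight-∷ x 0 b j) ⟨
    acceptable carry (scanFromRight (x ∷ b) (0 ∷ j)) ∎
    where open ≡-Reasoning
  routable≡acceptable (x ∷ b) (suc y ∷ j) carry = begin
    (carry ∨ isPos x) ∧ routable false b j
      ≡⟨ cong ((carry ∨ isPos x) ∧_) (routable≡acceptable b j false) ⟩
    (carry ∨ isPos x) ∧ accepts (scanFromRight b j)
      ≡⟨ acceptable-step-1 carry x y _ ⟩
    acceptable carry (step (scanFromRight b j) x (suc y))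
      ≡⟨ cong (acceptable carry) (scanFromRight-∷ x (suc y) b j) ⟨
    acceptable carry (scanFromRight (x ∷ b) (suc y ∷ j)) ∎
    where open ≡-Reasoning

  greedy≡routable : (b j : Vec ℕ m) →
    matchedWithin1 (greedy (zerosDesc b) (zerosDesc j)) ≡ routable false b j
  greedy≡routable b j = begin
    matchedWithin1 (greedy (zerosDesc b) (zerosDesc j))
      ≡⟨ cong₂ (λ u w → matchedWithin1 (greedy u w))
               (zerosDesc≡zerosFromRight b) (zerosDesc≡zerosFromRight j) ⟩
    matchedWithin1 (greedy (zerosFromRight (reverse (toList b))) (zerosFromRight (reverse (toList j))))
      ≡⟨ greedy-accepts free (reverse (toList b)) (reverse (toList j))
           (trans (length-reverse-toList b) (sym (length-reverse-toList j))) tt ⟩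
    accepts (scanFromRight b j)
      ≡⟨ routable≡acceptable b j false ⟨
    routable false b j ∎
    where open ≡-Reasoning

  private
    bit-∨-isPos : ∀ carry x → bit (carry ∨ isPos x) ≤ bit carry + x
    bit-∨-isPos true  x       = ℕ.m≤m+n 1 x
    bit-∨-isPos false zero    = z≤n
    bit-∨-isPos false (suc x) = s≤s z≤n

    T-∨-isPos : ∀ carry x → T (carry ∨ isPos x) → 1 ≤ bit carry + x
    T-∨-isPos true  x       _ = ℕ.m≤m+n 1 x
    T-∨-isPos false (suc x) _ = s≤s z≤n

    shift : ∀ {sj sb c n} x → sj + c ≤ sb → n ≤ c + x → sj + n ≤ sb + x
    shift {sj} {sb} {c} {n} x le n≤ = begin
      sj + n         ≤⟨ ℕ.+-monoʳ-≤ sj n≤ ⟩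
      sj + (c + x)   ≡⟨ ℕ.+-assoc sj c x ⟨
      (sj + c) + x   ≤⟨ ℕ.+-monoˡ-≤ x le ⟩
      sb + x         ∎
      where open ℕ.≤-Reasoning

    +0 : ∀ {a b} → a ≤ b → a + 0 ≤ b
    +0 {a} {b} = subst (_≤ b) (sym (ℕ.+-identityʳ a))

  -- A carry stands for a 1 of b not yet used by a 1 of j; hence bit carry on the left.
  routable⇒dominated : ∀ (b j : Vec ℕ m) carry {sb sj} → Binary j → T (routable carry b j) →
    sj + bit carry ≤ sb →
    T (andL (List.zipWith _≤ᵇ_ (psumsFrom sj (toList j)) (psumsFrom sb (toList b))))
  routable⇒dominated [] [] carry _ _ _ = tt
  routable⇒dominated (x ∷ b) (zero ∷ j) carry {sb} {sj} (z≤n AllV.∷ bin) r le =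
    Bool.T-∧ .Equivalence.from
      (ℕ.≤⇒≤ᵇ (shift {sj} x le z≤n) ,
       routable⇒dominated b j (carry ∨ isPos x) bin r
         (+0-left {sj} (shift {sj} x le (bit-∨-isPos carry x))))
    where
    +0-left : ∀ {sj n s} → sj + n ≤ s → (sj + 0) + n ≤ s
    +0-left {sj} {n} {s} = subst (λ a → a + n ≤ s) (sym (ℕ.+-identityʳ sj))
  routable⇒dominated (x ∷ b) (suc zero ∷ j) carry {sb} {sj} (s≤s z≤n AllV.∷ bin) r le =
    Bool.T-∧ .Equivalence.from
      (ℕ.≤⇒≤ᵇ head , routable⇒dominated b j false bin (proj₂ split) (+0 head))
    where
    split = Bool.T-∧ .Equivalence.to r
    head = shift {sj} x le (T-∨-isPos carry x (proj₁ split))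

  routable⇒dom : (b j : Vec ℕ m) → Binary j → T (routable false b j) → T (dom b j)
  routable⇒dom b j bin r =
    subst T (sym (cong₂ (λ u w → andL (List.zipWith _≤ᵇ_ u w))
                        (psums≡psumsFrom (toList j)) (psums≡psumsFrom (toList b))))
      (routable⇒dominated b j false bin r z≤n)

  private
    1⊔≡ᵇ1 : ∀ x → (1 ⊔ x ≡ᵇ 1) ≡ (x ≤ᵇ 1)
    1⊔≡ᵇ1 zero          = refl
    1⊔≡ᵇ1 (suc zero)    = refl
    1⊔≡ᵇ1 (suc (suc x)) = refl

    ⊔≤ᵇ1 : ∀ a c → (a ⊔ c ≤ᵇ 1) ≡ (a ≤ᵇ 1) ∧ (c ≤ᵇ 1)
    ⊔≤ᵇ1 zero          c             = refl
    ⊔≤ᵇ1 (suc zero)    zero          = refl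
    ⊔≤ᵇ1 (suc zero)    (suc zero)    = refl
    ⊔≤ᵇ1 (suc zero)    (suc (suc c)) = refl
    ⊔≤ᵇ1 (suc (suc a)) zero          = refl
    ⊔≤ᵇ1 (suc (suc a)) (suc zero)    = refl
    ⊔≤ᵇ1 (suc (suc a)) (suc (suc c)) = refl

  maxDiff : List (ℕ × ℕ) → ℕ
  maxDiff []            = 0
  maxDiff ((i , p) ∷ M) = (i ∸ p) ⊔ maxDiff M

  private
    maxDiff-unique : (F : List (ℕ × ℕ) → ℕ) → F [] ≡ 0 →
      (∀ i p M → F ((i , p) ∷ M) ≡ (i ∸ p) ⊔ F M) → ∀ M → F M ≡ maxDiff M
    maxDiff-unique F nil cons []            = nil
    maxDiff-unique F nil cons ((i , p) ∷ M) =
      trans (cons i p M) (cong ((i ∸ p) ⊔_) (maxDiff-unique F nil cons M))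

  -- As for zerosDesc, zOf folds a function local to Defs; abstracting 1 ⊔_ exposes it.
  zOf≡ : ∀ M → zOf M ≡ 1 ⊔ maxDiff M
  zOf≡ = generalised (maxDiff-unique inner refl (λ _ _ _ → refl))
    where
    inner : List (ℕ × ℕ) → ℕ
    inner = _
    generalised : (∀ M → inner M ≡ maxDiff M) → ∀ M → zOf M ≡ 1 ⊔ maxDiff M
    generalised eq M with 1 ⊔_
    ... | join = cong join (eq M)

  maxDiff≤ᵇ1 : ∀ M → (maxDiff M ≤ᵇ 1) ≡ allWithin1 M
  maxDiff≤ᵇ1 []            = refl
  maxDiff≤ᵇ1 ((i , p) ∷ M) =
    trans (⊔≤ᵇ1 (i ∸ p) (maxDiff M)) (cong ((i ∸ p ≤ᵇ 1) ∧_) (maxDiff≤ᵇ1 M))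

  zOf≡ᵇ1 : ∀ M → (zOf M ≡ᵇ 1) ≡ allWithin1 M
  zOf≡ᵇ1 M = trans (cong (_≡ᵇ 1) (zOf≡ M)) (trans (1⊔≡ᵇ1 (maxDiff M)) (maxDiff≤ᵇ1 M))

  dom₁≡ : (v w : Vec ℕ m) →
    dom₁ v w ≡ (dom v w ∧ dom (χ v) (χ w)) ∧ matchedWithin1 (greedy (zerosDesc v) (zerosDesc w))
  dom₁≡ v w with dom v w ∧ dom (χ v) (χ w)
  ... | false = refl
  ... | true with greedy (zerosDesc v) (zerosDesc w)
  ...   | nothing = refl
  ...   | just M  = zOf≡ᵇ1 M

  χ-binary : (b : Vec ℕ m) → Binary b → χ b ≡ b
  χ-binary []            AllV.[]            = refl
  χ-binary (zero ∷ b)    (_ AllV.∷ bin)     = cong (0 ∷_) (χ-binary b bin)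
  χ-binary (suc zero ∷ b) (_ AllV.∷ bin)    = cong (1 ∷_) (χ-binary b bin)
  χ-binary (suc (suc _) ∷ b) (s≤s () AllV.∷ _)

  dom₁≡routable : (b j : Vec ℕ m) → Binary b → Binary j → dom₁ b j ≡ routable false b j
  dom₁≡routable b j bin-b bin-j = begin
    dom₁ b j
      ≡⟨ dom₁≡ b j ⟩
    (dom b j ∧ dom (χ b) (χ j)) ∧ matchedWithin1 (greedy (zerosDesc b) (zerosDesc j))
      ≡⟨ cong₂ (λ u w → (dom b j ∧ dom u w) ∧ matchedWithin1 (greedy (zerosDesc b) (zerosDesc j)))
               (χ-binary b bin-b) (χ-binary j bin-j) ⟩
    (dom b j ∧ dom b j) ∧ matchedWithin1 (greedy (zerosDesc b) (zerosDesc j))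
      ≡⟨ cong ((dom b j ∧ dom b j) ∧_) (greedy≡routable b j) ⟩
    (dom b j ∧ dom b j) ∧ routable false b j
      ≡⟨ absorb (dom b j) (routable false b j) (routable⇒dom b j bin-j) ⟩
    routable false b j ∎
    where
    open ≡-Reasoning
    absorb : ∀ d r → (T r → T d) → (d ∧ d) ∧ r ≡ r
    absorb true  r     _   = refl
    absorb false false _   = refl
    absorb false true  r⇒d = ⊥-elim (r⇒d tt)

-- Rational arithmetic

open import Algebra.Bundles using (Ring)
import Data.Integer as ℤ
import Data.Integer.Properties as ℤ
open import Data.Nat.Coprimality using (1-coprimeTo) renaming (sym to coprime-sym)
open import Data.Rational as ℚ using (ℚ; 0ℚ; 1ℚ; ½; _+_; _*_; _-_; -_; _≤_; _<_; _⊓_; mkℚ)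
import Data.Rational.Properties as ℚ
open import Data.Rational.Solver using (module +-*-Solver)
open import Algebra.Properties.Semiring.Sum (Ring.semiring ℚ.+-*-ring)
  using (sum; sum-cong-≗; sum-replicate-zero; *-distribˡ-sum)

open +-*-Solver using (solve; _:+_; _:*_; _:-_; _:=_; con)

private variable
  c c' : ℚ

+-nonNeg : ∀ {x y} → 0ℚ ≤ x → 0ℚ ≤ y → 0ℚ ≤ x + y
+-nonNeg = ℚ.+-mono-≤

pos-+-nonNeg : ∀ {x y} → 0ℚ < x → 0ℚ ≤ y → 0ℚ < x + y
pos-+-nonNeg = ℚ.+-mono-<-≤

nonNeg-+-pos : ∀ {x y} → 0ℚ ≤ x → 0ℚ < y → 0ℚ < x + y
nonNeg-+-pos = ℚ.+-mono-≤-<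

*-nonNeg : ∀ {x y} → 0ℚ ≤ x → 0ℚ ≤ y → 0ℚ ≤ x * y
*-nonNeg {x} p q = subst (_≤ x * _) (ℚ.*-zeroʳ x) (ℚ.*-monoˡ-≤-nonNeg x {{ℚ.nonNegative p}} q)

*-pos : ∀ {x y} → 0ℚ < x → 0ℚ < y → 0ℚ < x * y
*-pos {x} p q = subst (_< x * _) (ℚ.*-zeroʳ x) (ℚ.*-monoʳ-<-pos x {{ℚ.positive p}} q)

≤⇒0≤- : ∀ {x y} → x ≤ y → 0ℚ ≤ y - x
≤⇒0≤- {x} {y} p = subst (_≤ y - x) (ℚ.+-inverseʳ x) (ℚ.+-monoˡ-≤ (- x) p)

<⇒0<- : ∀ {x y} → x < y → 0ℚ < y - x
<⇒0<- {x} {y} p = subst (_< y - x) (ℚ.+-inverseʳ x) (ℚ.+-monoˡ-< (- x) p)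

nonNeg∧≯0⇒≡0 : ∀ {x} → 0ℚ ≤ x → ¬ (0ℚ < x) → x ≡ 0ℚ
nonNeg∧≯0⇒≡0 p q = ℚ.≤-antisym (ℚ.≮⇒≥ q) p

pos-⊓ : ∀ {x y} → 0ℚ < x → 0ℚ < y → 0ℚ < x ⊓ y
pos-⊓ {x} {y} p q with ℚ.⊓-sel x y
... | inj₁ eq = subst (0ℚ <_) (sym eq) p
... | inj₂ eq = subst (0ℚ <_) (sym eq) q

pos-+⇒pos⊎pos : ∀ {x y} → 0ℚ ≤ x → 0ℚ ≤ y → 0ℚ < x + y → 0ℚ < x ⊎ 0ℚ < y
pos-+⇒pos⊎pos {x} {y} p q s with 0ℚ ℚ.<? x
... | yes x>0 = inj₁ x>0
... | no x≯0  =
  inj₂ (subst (0ℚ <_) (trans (cong (_+ y) (nonNeg∧≯0⇒≡0 p x≯0)) (ℚ.+-identityˡ y)) s)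

x-pos≢x : ∀ {e x} → 0ℚ < e → x - e ≢ x
x-pos≢x {e} {x} e>0 eq = ℚ.<-irrefl (sym e≡0) e>0
  where
  e≡0 : e ≡ 0ℚ
  e≡0 = begin
    e             ≡⟨ solve 2 (λ x e → e := x :- (x :- e)) refl x e ⟩
    x - (x - e)   ≡⟨ cong (λ z → x - z) eq ⟩
    x - x         ≡⟨ ℚ.+-inverseʳ x ⟩
    0ℚ            ∎
    where open ≡-Reasoning

mix : ℚ → ℚ → ℚ → ℚ
mix l x y = l * x + (1ℚ - l) * y

mix-idem : ∀ l x → mix l x x ≡ x
mix-idem = solve 2 (λ l x → l :* x :+ (con 1ℚ :- l) :* x := x) refl

mix-+ : ∀ l x y z w → mix l (x + z) (y + w) ≡ mix l x y + mix l z w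
mix-+ = solve 5 (λ l x y z w → l :* (x :+ z) :+ (con 1ℚ :- l) :* (y :+ w) :=
  (l :* x :+ (con 1ℚ :- l) :* y) :+ (l :* z :+ (con 1ℚ :- l) :* w)) refl

½-mix-± : ∀ x e → x ≡ mix ½ (x + e) (x - e)
½-mix-± = solve 2 (λ x e → x := con ½ :* (x :+ e) :+ (con 1ℚ :- con ½) :* (x :- e)) refl

½-mix-∓ : ∀ x e → x ≡ mix ½ (x - e) (x + e)
½-mix-∓ = solve 2 (λ x e → x := con ½ :* (x :- e) :+ (con 1ℚ :- con ½) :* (x :+ e)) refl

0<½ : 0ℚ < ½
0<½ = ℚ.positive⁻¹ ½

½<1 : ½ < 1ℚ
½<1 = ℚ.*<* (ℤ.+<+ (s≤s (s≤s z≤n)))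

mix≡0⇒≡0 : ∀ {l x y} → 0ℚ < l → l < 1ℚ → 0ℚ ≤ x → 0ℚ ≤ y →
           mix l x y ≡ 0ℚ → x ≡ 0ℚ × y ≡ 0ℚ
mix≡0⇒≡0 {l} {x} {y} l>0 l<1 x≥0 y≥0 eq =
  nonNeg∧≯0⇒≡0 x≥0 x≯0 , nonNeg∧≯0⇒≡0 y≥0 y≯0
  where
  x≯0 : ¬ (0ℚ < x)
  x≯0 x>0 = ℚ.<-irrefl (sym eq) (pos-+-nonNeg (*-pos l>0 x>0) (*-nonNeg (ℚ.<⇒≤ (<⇒0<- l<1)) y≥0))
  y≯0 : ¬ (0ℚ < y)
  y≯0 y>0 = ℚ.<-irrefl (sym eq) (nonNeg-+-pos (*-nonNeg (ℚ.<⇒≤ l>0) x≥0) (*-pos (<⇒0<- l<1) y>0))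

_∷ʳ_ : ∀ {A : Set} {m} → Vector A m → A → Vector A (suc m)
_∷ʳ_ {m = zero}  g x zero    = x
_∷ʳ_ {m = suc m} g x zero    = g zero
_∷ʳ_ {m = suc m} g x (suc i) = ((g ∘ suc) ∷ʳ x) i

ℕ→ℚ-coprime : ∀ n → ℕ→ℚ n ≡ mkℚ (ℤ.+ n) 0 (coprime-sym (1-coprimeTo n))
ℕ→ℚ-coprime n = ℚ.normalize-coprime (coprime-sym (1-coprimeTo n))

ℕ→ℚ-+ : ∀ x y → ℕ→ℚ (x ℕ.+ y) ≡ ℕ→ℚ x + ℕ→ℚ y
ℕ→ℚ-+ x y rewrite ℕ→ℚ-coprime x | ℕ→ℚ-coprime y =
  ℚ./-cong {ℤ.+ (x ℕ.+ y)} {1} {ℤ.+ x ℤ.* ℤ.+ 1 ℤ.+ ℤ.+ y ℤ.* ℤ.+ 1} {1}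
    (sym (cong₂ ℤ._+_ (ℤ.*-identityʳ (ℤ.+ x)) (ℤ.*-identityʳ (ℤ.+ y)))) refl

ℕ→ℚ-nonneg : ∀ n → 0ℚ ≤ ℕ→ℚ n
ℕ→ℚ-nonneg n rewrite ℕ→ℚ-coprime n = ℚ.nonNegative⁻¹ _

ℕ→ℚ-pos : ∀ n → 0ℚ < ℕ→ℚ (suc n)
ℕ→ℚ-pos n rewrite ℕ→ℚ-coprime (suc n) = ℚ.positive⁻¹ _

sumℚ-++ : ∀ xs ys → sumℚ (xs ++ ys) ≡ sumℚ xs + sumℚ ys
sumℚ-++ []       ys = sym (ℚ.+-identityˡ _)
sumℚ-++ (x ∷ xs) ys = trans (cong (x +_) (sumℚ-++ xs ys)) (sym (ℚ.+-assoc x _ _))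

sumℚ-concatMap : ∀ {A : Set} (h : A → List ℚ) xs →
  sumℚ (concatMap h xs) ≡ sumℚ (List.map (sumℚ ∘ h) xs)
sumℚ-concatMap h []       = refl
sumℚ-concatMap h (x ∷ xs) = trans (sumℚ-++ (h x) _) (cong (sumℚ (h x) +_) (sumℚ-concatMap h xs))

sumℚ-tabulate : (g : Fin m → ℚ) → sumℚ (tabulate g) ≡ sum g
sumℚ-tabulate {zero}  g = refl
sumℚ-tabulate {suc m} g = cong (g zero +_) (sumℚ-tabulate (g ∘ suc))

sumℚ-map-allFin : (F : Fin m → ℚ) → sumℚ (List.map F (allFin m)) ≡ sum F
sumℚ-map-allFin F = trans (cong sumℚ (List.map-tabulate (λ i → i) F)) (sumℚ-tabulate F)

sumℚ-map-map-allFin : ∀ {A : Set} (F : A → ℚ) (g : Fin m → A) →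
  sumℚ (List.map F (List.map g (allFin m))) ≡ sum (F ∘ g)
sumℚ-map-map-allFin {m} F g =
  trans (cong sumℚ (sym (List.map-∘ {g = F} {f = g} (allFin m)))) (sumℚ-map-allFin (F ∘ g))

sumℚ-map-family : ∀ {A : Set} {m′} (F : A → ℚ) (g : Fin m → Fin m′ → A) →
  sumℚ (List.map F (concatMap (λ i → List.map (g i) (allFin m′)) (allFin m))) ≡
  sum (λ i → sum (λ j → F (g i j)))
sumℚ-map-family {m} {m′ = m′} F g = begin
  sumℚ (List.map F (concatMap (λ i → List.map (g i) (allFin m′)) (allFin m)))
    ≡⟨ cong sumℚ (List.map-concatMap F (λ i → List.map (g i) (allFin m′)) (allFin m)) ⟩
  sumℚ (concatMap (λ i → List.map F (List.map (g i) (allFin m′))) (allFin m))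
    ≡⟨ sumℚ-concatMap (λ i → List.map F (List.map (g i) (allFin m′))) (allFin m) ⟩
  sumℚ (List.map (λ i → sumℚ (List.map F (List.map (g i) (allFin m′)))) (allFin m))
    ≡⟨ sumℚ-map-allFin (λ i → sumℚ (List.map F (List.map (g i) (allFin m′)))) ⟩
  sum (λ i → sumℚ (List.map F (List.map (g i) (allFin m′))))
    ≡⟨ sum-cong-≗ (λ i → sumℚ-map-map-allFin F (g i)) ⟩
  sum (λ i → sum (λ j → F (g i j))) ∎
  where open ≡-Reasoning

δᶠ : Fin m → Fin m → ℚ
δᶠ p q = if does (p Fin.≟ q) then 1ℚ else 0ℚ

∑-0 : (g : Fin m → ℚ) → (∀ i → g i ≡ 0ℚ) → sum g ≡ 0ℚ
∑-0 {m} g g≡0 = trans (sum-cong-≗ g≡0) (sum-replicate-zero m)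

∑-distrib-- : (f g : Fin m → ℚ) → sum (λ i → f i - g i) ≡ sum f - sum g
∑-distrib-- {zero}  f g = refl
∑-distrib-- {suc m} f g = trans (cong (f zero - g zero +_) (∑-distrib-- (f ∘ suc) (g ∘ suc)))
  (solve 4 (λ a b c d → (a :- b) :+ (c :- d) := (a :+ c) :- (b :+ d)) refl
     (f zero) (g zero) (sum (f ∘ suc)) (sum (g ∘ suc)))

∑-δᶠ : (g : Fin m → ℚ) → ∀ i₀ → sum (λ i → δᶠ i i₀ * g i) ≡ g i₀
∑-δᶠ {suc m} g zero = begin
  1ℚ * g zero + sum (λ i → 0ℚ * g (suc i))
    ≡⟨ cong₂ _+_ (ℚ.*-identityˡ (g zero)) (∑-0 _ (λ i → ℚ.*-zeroˡ (g (suc i)))) ⟩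
  g zero + 0ℚ ≡⟨ ℚ.+-identityʳ _ ⟩
  g zero      ∎
  where open ≡-Reasoning
∑-δᶠ {suc m} g (suc i₀) = begin
  0ℚ * g zero + sum (λ i → δᶠ i i₀ * g (suc i))
    ≡⟨ cong (_+ sum (λ i → δᶠ i i₀ * g (suc i))) (ℚ.*-zeroˡ (g zero)) ⟩
  0ℚ + sum (λ i → δᶠ i i₀ * g (suc i)) ≡⟨ ℚ.+-identityˡ _ ⟩
  sum (λ i → δᶠ i i₀ * g (suc i))      ≡⟨ ∑-δᶠ (g ∘ suc) i₀ ⟩
  g (suc i₀)                           ∎
  where open ≡-Reasoning

∑-δᶠ-inject₁ : (g : Fin m → ℚ) → ∀ j₀ →
  sum (λ j → g j * δᶠ (inject₁ j) j₀) ≡ (g ∷ʳ 0ℚ) j₀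
∑-δᶠ-inject₁ {zero}  g zero = refl
∑-δᶠ-inject₁ {suc m} g zero = begin
  g zero * 1ℚ + sum (λ j → g (suc j) * 0ℚ)
    ≡⟨ cong₂ _+_ (ℚ.*-identityʳ (g zero)) (∑-0 _ (λ j → ℚ.*-zeroʳ (g (suc j)))) ⟩
  g zero + 0ℚ ≡⟨ ℚ.+-identityʳ _ ⟩
  g zero      ∎
  where open ≡-Reasoning
∑-δᶠ-inject₁ {suc m} g (suc j₀) = begin
  g zero * 0ℚ + sum (λ j → g (suc j) * δᶠ (inject₁ j) j₀)
    ≡⟨ cong (_+ sum (λ j → g (suc j) * δᶠ (inject₁ j) j₀)) (ℚ.*-zeroʳ (g zero)) ⟩
  0ℚ + sum (λ j → g (suc j) * δᶠ (inject₁ j) j₀) ≡⟨ ℚ.+-identityˡ _ ⟩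
  sum (λ j → g (suc j) * δᶠ (inject₁ j) j₀)      ≡⟨ ∑-δᶠ-inject₁ (g ∘ suc) j₀ ⟩
  ((g ∘ suc) ∷ʳ 0ℚ) j₀                           ∎
  where open ≡-Reasoning

∑-δᶠ-suc : (g : Fin m → ℚ) → ∀ j₀ → sum (λ j → g j * δᶠ (suc j) j₀) ≡ (0ℚ ◃ g) j₀
∑-δᶠ-suc g zero     = ∑-0 _ (λ j → ℚ.*-zeroʳ (g j))
∑-δᶠ-suc g (suc j₀) = trans (sum-cong-≗ (λ j → ℚ.*-comm (g j) (δᶠ j j₀))) (∑-δᶠ g j₀)

∷ʳ-δᶠ-last : (g : Fin m → ℚ) → ∀ t i₀ →
  (g ∷ʳ 0ℚ) i₀ + t * δᶠ (fromℕ m) i₀ ≡ (g ∷ʳ t) i₀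
∷ʳ-δᶠ-last {zero}  g t zero     = trans (ℚ.+-identityˡ _) (ℚ.*-identityʳ t)
∷ʳ-δᶠ-last {suc m} g t zero     = trans (cong (g zero +_) (ℚ.*-zeroʳ t)) (ℚ.+-identityʳ _)
∷ʳ-δᶠ-last {suc m} g t (suc i₀) = ∷ʳ-δᶠ-last (g ∘ suc) t i₀

-- Levels

-- One row of G(n,k) carrying a flow: rise i on the edge up from column i, pass i on the
-- edge from column i to i + 1, exit on the edge from the last column to the sink.
-- Balanced c d L says that column i receives d i, column 0 also c from the left.
record Level (n' : ℕ) : Set where
  constructor level
  field
    rise : Fin (suc n') → ℚ
    pass : Fin n' → ℚ
    exit : ℚ

open Level public

tailᴸ : Level (suc n') → Level n'
tailᴸ L = level (rise L ∘ suc) (pass L ∘ suc) (exit L)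

consᴸ : ℚ → ℚ → Level n' → Level (suc n')
consᴸ u r L = level (u ◃ rise L) (r ◃ pass L) (exit L)

onward : Level n' → Fin (suc n') → ℚ
onward L = pass L ∷ʳ exit L

Balanced : ℚ → Vector ℚ (suc n') → Level n' → Set
Balanced {zero}   c d L = rise L zero + exit L ≡ c + d zero
Balanced {suc n'} c d L =
  rise L zero + pass L zero ≡ c + d zero × Balanced (pass L zero) (d ∘ suc) (tailᴸ L)

record _≈ᴸ_ (L M : Level n') : Set where
  constructor mk≈ᴸ
  field
    rise-≗ : rise L ≗ rise M
    pass-≗ : pass L ≗ pass M
    exit-≡ : exit L ≡ exit M

open _≈ᴸ_ public

≈ᴸ-refl : ∀ {L : Level n'} → L ≈ᴸ L
≈ᴸ-refl = mk≈ᴸ (λ _ → refl) (λ _ → refl) refl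

≈ᴸ-trans : ∀ {L M N : Level n'} → L ≈ᴸ M → M ≈ᴸ N → L ≈ᴸ N
≈ᴸ-trans (mk≈ᴸ r p e) (mk≈ᴸ r' p' e') =
  mk≈ᴸ (λ i → trans (r i) (r' i)) (λ i → trans (p i) (p' i)) (trans e e')

consᴸ-≈ : ∀ {u u' r r'} {L M : Level n'} → u ≡ u' → r ≡ r' → L ≈ᴸ M →
          consᴸ u r L ≈ᴸ consᴸ u' r' M
consᴸ-≈ u≡ r≡ (mk≈ᴸ rs ps e) =
  mk≈ᴸ (λ { zero → u≡ ; (suc i) → rs i }) (λ { zero → r≡ ; (suc i) → ps i }) e

tailᴸ-≈ : ∀ {L M : Level (suc n')} → L ≈ᴸ M → tailᴸ L ≈ᴸ tailᴸ M
tailᴸ-≈ (mk≈ᴸ r p e) = mk≈ᴸ (r ∘ suc) (p ∘ suc) e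

Balanced-cong : ∀ {d d' : Vector ℚ (suc n')} {L M} →
  c ≡ c' → d ≗ d' → L ≈ᴸ M → Balanced c d L → Balanced c' d' M
Balanced-cong {zero} {c} refl d≗ (mk≈ᴸ r p e) bal =
  trans (sym (cong₂ _+_ (r zero) e)) (trans bal (cong (c +_) (d≗ zero)))
Balanced-cong {suc n'} {c} refl d≗ L≈@(mk≈ᴸ r p e) (bal₀ , bal) =
  trans (sym (cong₂ _+_ (r zero) (p zero))) (trans bal₀ (cong (c +_) (d≗ zero))) ,
  Balanced-cong (p zero) (d≗ ∘ suc) (tailᴸ-≈ L≈) bal

record Nonneg (L : Level n') : Set where
  constructor nonneg
  field
    rise-nonneg : ∀ i → 0ℚ ≤ rise L i
    pass-nonneg : ∀ i → 0ℚ ≤ pass L i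
    exit-nonneg : 0ℚ ≤ exit L

open Nonneg public

tailᴸ-nonneg : ∀ {L : Level (suc n')} → Nonneg L → Nonneg (tailᴸ L)
tailᴸ-nonneg (nonneg r p e) = nonneg (r ∘ suc) (p ∘ suc) e

consᴸ-nonneg : ∀ {u r} {L : Level n'} → 0ℚ ≤ u → 0ℚ ≤ r → Nonneg L → Nonneg (consᴸ u r L)
consᴸ-nonneg u≥0 r≥0 (nonneg rs ps e) =
  nonneg (λ { zero → u≥0 ; (suc i) → rs i }) (λ { zero → r≥0 ; (suc i) → ps i }) e

onward-nonneg : ∀ {L : Level n'} → Nonneg L → ∀ i → 0ℚ ≤ onward L i
onward-nonneg {zero}   L≥0 zero    = exit-nonneg L≥0
onward-nonneg {suc n'} L≥0 zero    = pass-nonneg L≥0 zero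
onward-nonneg {suc n'} L≥0 (suc i) = onward-nonneg (tailᴸ-nonneg L≥0) i

mixᴸ : ℚ → Level n' → Level n' → Level n'
mixᴸ l L M = level (λ i → mix l (rise L i) (rise M i)) (λ i → mix l (pass L i) (pass M i))
                   (mix l (exit L) (exit M))

Balanced⇒columns : ∀ {d} {L : Level n'} → Balanced c d L →
  ∀ i → rise L i + onward L i ≡ (c ◃ pass L) i + d i
Balanced⇒columns {zero}   bal         zero    = bal
Balanced⇒columns {suc n'} (bal₀ , bal) zero    = bal₀
Balanced⇒columns {suc n'} {d = d} {L} (bal₀ , bal) (suc i) =
  trans (Balanced⇒columns bal i) (cong (_+ d (suc i)) (head◃tail (pass L) i))
  where
  head◃tail : ∀ {m} (f : Vector ℚ (suc m)) → (f zero ◃ f ∘ suc) ≗ f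
  head◃tail f zero    = refl
  head◃tail f (suc i) = refl

columns⇒Balanced : ∀ {d} {L : Level n'} →
  (∀ i → rise L i + onward L i ≡ (c ◃ pass L) i + d i) → Balanced c d L
columns⇒Balanced {zero}   cols = cols zero
columns⇒Balanced {suc n'} {d = d} {L} cols =
  cols zero , columns⇒Balanced (λ i → trans (cols (suc i)) (cong (_+ d (suc i)) (shift i)))
  where
  shift : ∀ i → pass L i ≡ (pass L zero ◃ pass L ∘ suc) i
  shift zero    = refl
  shift (suc i) = refl

Balanced-total : ∀ {d} {L : Level n'} → Balanced c d L → sum (rise L) + exit L ≡ c + sum d
Balanced-total {zero} {c} {d} {L} bal = begin
  (rise L zero + 0ℚ) + exit L ≡⟨ cong (_+ exit L) (ℚ.+-identityʳ (rise L zero)) ⟩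
  rise L zero + exit L        ≡⟨ bal ⟩
  c + d zero                  ≡⟨ cong (c +_) (ℚ.+-identityʳ _) ⟨
  c + (d zero + 0ℚ)           ∎
  where open ≡-Reasoning
Balanced-total {suc n'} {c} {d} {L} (bal₀ , bal) = begin
  (u + sum (rise L ∘ suc)) + exit L   ≡⟨ ℚ.+-assoc u _ _ ⟩
  u + (sum (rise L ∘ suc) + exit L)   ≡⟨ cong (u +_) (Balanced-total bal) ⟩
  u + (p + sum (d ∘ suc))             ≡⟨ ℚ.+-assoc u p _ ⟨
  (u + p) + sum (d ∘ suc)             ≡⟨ cong (_+ sum (d ∘ suc)) bal₀ ⟩
  (c + d zero) + sum (d ∘ suc)        ≡⟨ ℚ.+-assoc c _ _ ⟩
  c + sum d                           ∎
  where
  open ≡-Reasoning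
  u = rise L zero
  p = pass L zero

risen : ℕ → ℚ → ℚ
risen zero    x = 0ℚ
risen (suc _) x = x

carried : ℕ → ℚ → ℚ
carried zero    x = x
carried (suc _) x = 0ℚ

risen+carried : ∀ y x → risen y x + carried y x ≡ x
risen+carried zero    x = ℚ.+-identityˡ x
risen+carried (suc _) x = ℚ.+-identityʳ x

risen-nonneg : ∀ y {x} → 0ℚ ≤ x → 0ℚ ≤ risen y x
risen-nonneg zero    x≥0 = ℚ.≤-refl
risen-nonneg (suc _) x≥0 = x≥0

carried-nonneg : ∀ y {x} → 0ℚ ≤ x → 0ℚ ≤ carried y x
carried-nonneg zero    x≥0 = x≥0
carried-nonneg (suc _) x≥0 = ℚ.≤-refl

risen-mix : ∀ y l x x' → risen y (mix l x x') ≡ mix l (risen y x) (risen y x')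
risen-mix zero    l x x' = sym (mix-idem l 0ℚ)
risen-mix (suc _) l x x' = refl

carried-mix : ∀ y l x x' → carried y (mix l x x') ≡ mix l (carried y x) (carried y x')
carried-mix zero    l x x' = refl
carried-mix (suc _) l x x' = sym (mix-idem l 0ℚ)

route : ℚ → Vector ℚ (suc n') → Vec ℕ (suc n') → Level n'
route {zero}   c d (y ∷ []) = level (λ _ → risen y (c + d zero)) (λ ()) (carried y (c + d zero))
route {suc n'} c d (y ∷ j)  = consᴸ (risen y x) (carried y x) (route (carried y x) (d ∘ suc) j)
  where x = c + d zero

route-balanced : ∀ c d (j : Vec ℕ (suc n')) → Balanced c d (route c d j)
route-balanced {zero}   c d (y ∷ []) = risen+carried y (c + d zero)
route-balanced {suc n'} c d (y ∷ j)  =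
  risen+carried y (c + d zero) , route-balanced (carried y (c + d zero)) (d ∘ suc) j

route-nonneg : ∀ {d} (j : Vec ℕ (suc n')) → 0ℚ ≤ c → (∀ i → 0ℚ ≤ d i) →
               Nonneg (route c d j)
route-nonneg {zero}   (y ∷ []) c≥0 d≥0 =
  nonneg (λ _ → risen-nonneg y x≥0) (λ ()) (carried-nonneg y x≥0)
  where x≥0 = +-nonNeg c≥0 (d≥0 zero)
route-nonneg {suc n'} (y ∷ j)  c≥0 d≥0 =
  consᴸ-nonneg (risen-nonneg y x≥0) (carried-nonneg y x≥0)
    (route-nonneg j (carried-nonneg y x≥0) (d≥0 ∘ suc))
  where x≥0 = +-nonNeg c≥0 (d≥0 zero)

route-cong : ∀ {d d'} (j : Vec ℕ (suc n')) → c ≡ c' → d ≗ d' → route c d j ≈ᴸ route c' d' j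
route-cong {zero}   {c} (y ∷ []) refl d≗ =
  mk≈ᴸ (λ _ → cong (risen y) x≡) (λ ()) (cong (carried y) x≡)
  where x≡ = cong (c +_) (d≗ zero)
route-cong {suc n'} {c} (y ∷ j)  refl d≗ =
  consᴸ-≈ (cong (risen y) x≡) (cong (carried y) x≡)
          (route-cong j (cong (carried y) x≡) (d≗ ∘ suc))
  where x≡ = cong (c +_) (d≗ zero)

route-mix : ∀ l c c' d d' (j : Vec ℕ (suc n')) →
  route (mix l c c') (λ i → mix l (d i) (d' i)) j ≈ᴸ mixᴸ l (route c d j) (route c' d' j)
route-mix {zero}   l c c' d d' (y ∷ []) =
  mk≈ᴸ (λ _ → trans (cong (risen y) x≡) (risen-mix y l _ _)) (λ ())
       (trans (cong (carried y) x≡) (carried-mix y l _ _))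
  where x≡ = sym (mix-+ l c c' (d zero) (d' zero))
route-mix {suc n'} l c c' d d' (y ∷ j)  =
  mk≈ᴸ (λ { zero → trans (cong (risen y) x≡) (risen-mix y l _ _) ; (suc i) → rise-≗ rest i })
       (λ { zero → carry≡ ; (suc i) → pass-≗ rest i })
       (exit-≡ rest)
  where
  x≡ = sym (mix-+ l c c' (d zero) (d' zero))
  carry≡ = trans (cong (carried y) x≡) (carried-mix y l _ _)
  rest = ≈ᴸ-trans (route-cong j carry≡ (λ _ → refl))
                  (route-mix l (carried y (c + d zero)) (carried y (c' + d' zero)) (d ∘ suc) (d' ∘ suc) j)

route₀-mix : ∀ l d d′ (j : Vec ℕ (suc n')) →
  route 0ℚ (λ i → mix l (d i) (d′ i)) j ≈ᴸ mixᴸ l (route 0ℚ d j) (route 0ℚ d′ j)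
route₀-mix l d d′ j =
  ≈ᴸ-trans (route-cong j (sym (mix-idem l 0ℚ)) (λ _ → refl)) (route-mix l 0ℚ 0ℚ d d′ j)

Obeys : ℕ → ℚ → ℚ → Set
Obeys zero    u o = u ≡ 0ℚ
Obeys (suc _) u o = o ≡ 0ℚ

RoutedBy : Vec ℕ (suc n') → Level n' → Set
RoutedBy j L = ∀ i → Obeys (lookup j i) (rise L i) (onward L i)

route-routedBy : ∀ c d (j : Vec ℕ (suc n')) → RoutedBy j (route c d j)
route-routedBy {zero}   c d (zero  ∷ []) zero    = refl
route-routedBy {zero}   c d (suc _ ∷ []) zero    = refl
route-routedBy {suc n'} c d (zero  ∷ j)  zero    = refl
route-routedBy {suc n'} c d (suc _ ∷ j)  zero    = refl
route-routedBy {suc n'} c d (y ∷ j)      (suc i) = route-routedBy _ (d ∘ suc) j i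

obeys-solve : ∀ y {u o x} → u + o ≡ x → Obeys y u o → u ≡ risen y x × o ≡ carried y x
obeys-solve zero    {u} {o} eq refl = refl , trans (sym (ℚ.+-identityˡ o)) eq
obeys-solve (suc _) {u} {o} eq refl = trans (sym (ℚ.+-identityʳ u)) eq , refl

routedBy⇒≈route : ∀ {d} {L : Level n'} (j : Vec ℕ (suc n')) →
  Balanced c d L → RoutedBy j L → L ≈ᴸ route c d j
routedBy⇒≈route {zero}   (y ∷ []) bal rt with obeys-solve y bal (rt zero)
... | u≡ , e≡ = mk≈ᴸ (λ { zero → u≡ }) (λ ()) e≡
routedBy⇒≈route {suc n'} (y ∷ j) (bal₀ , bal) rt with obeys-solve y bal₀ (rt zero)
... | u≡ , p≡ =
  mk≈ᴸ (λ { zero → u≡ ; (suc i) → rise-≗ rest i })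
       (λ { zero → p≡ ; (suc i) → pass-≗ rest i })
       (exit-≡ rest)
  where
  rest = routedBy⇒≈route j (Balanced-cong p≡ (λ _ → refl) ≈ᴸ-refl bal) (rt ∘ suc)

record Absorption (c : ℚ) (d : Vector ℚ (suc n')) (X : Level n') (η : ℚ) : Set where
  field
    ε              : ℚ
    ε-pos          : 0ℚ < ε
    ε≤η            : ε ≤ η
    plus minus     : Level n'
    plus-balanced  : Balanced (c + ε) d plus
    minus-balanced : Balanced (c - ε) d minus
    plus-nonneg    : Nonneg plus
    minus-nonneg   : Nonneg minus
    midpoint       : X ≈ᴸ mixᴸ ½ plus minus

record Rerouting (c : ℚ) (d : Vector ℚ (suc n')) (X : Level n') (i : Fin (suc n')) : Set where
  field
    plus minus     : Level n'
    plus-balanced  : Balanced c d plus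
    minus-balanced : Balanced c d minus
    plus-nonneg    : Nonneg plus
    minus-nonneg   : Nonneg minus
    midpoint       : X ≈ᴸ mixᴸ ½ plus minus
    moved          : rise plus i ≢ rise X i

private
  feed-first : ∀ a b c d e → a + b ≡ c + d → (a + e) + b ≡ (c + e) + d
  feed-first a b c d e eq = begin
    (a + e) + b   ≡⟨ solve 3 (λ a b e → (a :+ e) :+ b := (a :+ b) :+ e) refl a b e ⟩
    (a + b) + e   ≡⟨ cong (_+ e) eq ⟩
    (c + d) + e   ≡⟨ solve 3 (λ c d e → (c :+ d) :+ e := (c :+ e) :+ d) refl c d e ⟩
    (c + e) + d   ∎
    where open ≡-Reasoning

  feed-second : ∀ a b c d e → a + b ≡ c + d → a + (b + e) ≡ (c + e) + d
  feed-second a b c d e eq = trans (sym (ℚ.+-assoc a b e)) (trans (cong (_+ e) eq)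
    (solve 3 (λ c d e → (c :+ d) :+ e := (c :+ e) :+ d) refl c d e))

  trade : ∀ a b s e → a + b ≡ s → (a - e) + (b + e) ≡ s
  trade a b s e eq = trans (solve 3 (λ a b e → (a :- e) :+ (b :+ e) := a :+ b) refl a b e) eq

  trade′ : ∀ a b s e → a + b ≡ s → (a + e) + (b - e) ≡ s
  trade′ a b s e eq = trans (solve 3 (λ a b e → (a :+ e) :+ (b :- e) := a :+ b) refl a b e) eq

  ½-mix-idem : ∀ x → x ≡ mix ½ x x
  ½-mix-idem x = sym (mix-idem ½ x)

  +ε-nonneg : ∀ {x ε} → 0ℚ ≤ x → 0ℚ < ε → 0ℚ ≤ x + ε
  +ε-nonneg x≥0 ε>0 = +-nonNeg x≥0 (ℚ.<⇒≤ ε>0)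

-- The extra inflow ±ε is sent along a path of positive flow: up at the first column
-- with positive rise, otherwise onward.
absorb : ∀ {d} {X : Level n'} → Balanced c d X → Nonneg X → (∀ i → 0ℚ ≤ d i) → 0ℚ < c →
         ∀ η → 0ℚ < η → Absorption c d X η
absorb {zero} {c} {d} {X} bal X≥0 d≥0 c>0 η η>0
  with pos-+⇒pos⊎pos (rise-nonneg X≥0 zero) (exit-nonneg X≥0)
         (subst (0ℚ <_) (sym bal) (pos-+-nonNeg c>0 (d≥0 zero)))
... | inj₁ u>0 = record
  { ε = ε ; ε-pos = pos-⊓ η>0 u>0 ; ε≤η = ℚ.p⊓q≤p η u
  ; plus = level (λ _ → u + ε) (λ ()) t ; minus = level (λ _ → u - ε) (λ ()) t
  ; plus-balanced = feed-first u t c (d zero) ε bal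
  ; minus-balanced = feed-first u t c (d zero) (- ε) bal
  ; plus-nonneg = nonneg (λ _ → +ε-nonneg (rise-nonneg X≥0 zero) (pos-⊓ η>0 u>0)) (λ ())
                         (exit-nonneg X≥0)
  ; minus-nonneg = nonneg (λ _ → ≤⇒0≤- (ℚ.p⊓q≤q η u)) (λ ()) (exit-nonneg X≥0)
  ; midpoint = mk≈ᴸ (λ { zero → ½-mix-± u ε }) (λ ()) (½-mix-idem t)
  }
  where
  u = rise X zero
  t = exit X
  ε = η ⊓ u
... | inj₂ t>0 = record
  { ε = ε ; ε-pos = pos-⊓ η>0 t>0 ; ε≤η = ℚ.p⊓q≤p η t
  ; plus = level (rise X) (λ ()) (t + ε) ; minus = level (rise X) (λ ()) (t - ε)
  ; plus-balanced = feed-second u t c (d zero) ε bal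
  ; minus-balanced = feed-second u t c (d zero) (- ε) bal
  ; plus-nonneg = nonneg (rise-nonneg X≥0) (λ ()) (+ε-nonneg (exit-nonneg X≥0) (pos-⊓ η>0 t>0))
  ; minus-nonneg = nonneg (rise-nonneg X≥0) (λ ()) (≤⇒0≤- (ℚ.p⊓q≤q η t))
  ; midpoint = mk≈ᴸ (λ i → ½-mix-idem (rise X i)) (λ ()) (½-mix-± t ε)
  }
  where
  u = rise X zero
  t = exit X
  ε = η ⊓ t
absorb {suc n'} {c} {d} {X} (bal₀ , bal) X≥0 d≥0 c>0 η η>0
  with pos-+⇒pos⊎pos (rise-nonneg X≥0 zero) (pass-nonneg X≥0 zero)
         (subst (0ℚ <_) (sym bal₀) (pos-+-nonNeg c>0 (d≥0 zero)))
... | inj₁ u>0 = record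
  { ε = ε ; ε-pos = pos-⊓ η>0 u>0 ; ε≤η = ℚ.p⊓q≤p η u
  ; plus = consᴸ (u + ε) p (tailᴸ X) ; minus = consᴸ (u - ε) p (tailᴸ X)
  ; plus-balanced = feed-first u p c (d zero) ε bal₀ , bal
  ; minus-balanced = feed-first u p c (d zero) (- ε) bal₀ , bal
  ; plus-nonneg = consᴸ-nonneg (+ε-nonneg (rise-nonneg X≥0 zero) (pos-⊓ η>0 u>0))
                    (pass-nonneg X≥0 zero) (tailᴸ-nonneg X≥0)
  ; minus-nonneg = consᴸ-nonneg (≤⇒0≤- (ℚ.p⊓q≤q η u)) (pass-nonneg X≥0 zero)
                                (tailᴸ-nonneg X≥0)
  ; midpoint = mk≈ᴸ (λ { zero → ½-mix-± u ε ; (suc i) → ½-mix-idem (rise X (suc i)) })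
                    (λ { zero → ½-mix-idem p ; (suc i) → ½-mix-idem (pass X (suc i)) })
                    (½-mix-idem (exit X))
  }
  where
  u = rise X zero
  p = pass X zero
  ε = η ⊓ u
... | inj₂ p>0 = record
  { ε = ε ; ε-pos = ε-pos ; ε≤η = ℚ.≤-trans ε≤η (ℚ.p⊓q≤p η p)
  ; plus = consᴸ u (p + ε) plus ; minus = consᴸ u (p - ε) minus
  ; plus-balanced = feed-second u p c (d zero) ε bal₀ , plus-balanced
  ; minus-balanced = feed-second u p c (d zero) (- ε) bal₀ , minus-balanced
  ; plus-nonneg = consᴸ-nonneg (rise-nonneg X≥0 zero) (+ε-nonneg (pass-nonneg X≥0 zero) ε-pos)
                               plus-nonneg
  ; minus-nonneg = consᴸ-nonneg (rise-nonneg X≥0 zero) (≤⇒0≤- (ℚ.≤-trans ε≤η (ℚ.p⊓q≤q η p)))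
                                minus-nonneg
  ; midpoint = mk≈ᴸ (λ { zero → ½-mix-idem u ; (suc i) → rise-≗ midpoint i })
                    (λ { zero → ½-mix-± p ε ; (suc i) → pass-≗ midpoint i }) (exit-≡ midpoint)
  }
  where
  u = rise X zero
  p = pass X zero
  open Absorption (absorb bal (tailᴸ-nonneg X≥0) (d≥0 ∘ suc) p>0 (η ⊓ p) (pos-⊓ η>0 p>0))

-- Flow leaving column i both upwards and onwards can be shifted by ±ε between the two
-- directions, the onward change being absorbed downstream.
reroute : ∀ {d} {X : Level n'} → Balanced c d X → Nonneg X → (∀ i → 0ℚ ≤ d i) →
          ∀ i → 0ℚ < rise X i → 0ℚ < onward X i → Rerouting c d X i
reroute {zero} {c} {d} {X} bal X≥0 d≥0 zero u>0 t>0 = record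
  { plus = level (λ _ → u - ε) (λ ()) (t + ε) ; minus = level (λ _ → u + ε) (λ ()) (t - ε)
  ; plus-balanced = trade u t (c + d zero) ε bal
  ; minus-balanced = trade′ u t (c + d zero) ε bal
  ; plus-nonneg = nonneg (λ _ → ≤⇒0≤- (ℚ.p⊓q≤p u t)) (λ ())
                         (+ε-nonneg (exit-nonneg X≥0) ε>0)
  ; minus-nonneg = nonneg (λ _ → +ε-nonneg (rise-nonneg X≥0 zero) ε>0) (λ ())
                          (≤⇒0≤- (ℚ.p⊓q≤q u t))
  ; midpoint = mk≈ᴸ (λ { zero → ½-mix-∓ u ε }) (λ ()) (½-mix-± t ε)
  ; moved = x-pos≢x ε>0
  }
  where
  u = rise X zero
  t = exit X
  ε = u ⊓ t
  ε>0 = pos-⊓ u>0 t>0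
reroute {suc n'} {c} {d} {X} (bal₀ , bal) X≥0 d≥0 zero u>0 p>0 = record
  { plus = consᴸ (u - ε) (p + ε) plus ; minus = consᴸ (u + ε) (p - ε) minus
  ; plus-balanced = trade u p (c + d zero) ε bal₀ , plus-balanced
  ; minus-balanced = trade′ u p (c + d zero) ε bal₀ , minus-balanced
  ; plus-nonneg = consᴸ-nonneg (≤⇒0≤- (ℚ.≤-trans ε≤η (ℚ.p⊓q≤p u p)))
                    (+ε-nonneg (pass-nonneg X≥0 zero) ε-pos) plus-nonneg
  ; minus-nonneg = consᴸ-nonneg (+ε-nonneg (rise-nonneg X≥0 zero) ε-pos)
                     (≤⇒0≤- (ℚ.≤-trans ε≤η (ℚ.p⊓q≤q u p))) minus-nonneg
  ; midpoint = mk≈ᴸ (λ { zero → ½-mix-∓ u ε ; (suc i) → rise-≗ midpoint i })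
                    (λ { zero → ½-mix-± p ε ; (suc i) → pass-≗ midpoint i }) (exit-≡ midpoint)
  ; moved = x-pos≢x ε-pos
  }
  where
  u = rise X zero
  p = pass X zero
  open Absorption (absorb bal (tailᴸ-nonneg X≥0) (d≥0 ∘ suc) p>0 (u ⊓ p) (pos-⊓ u>0 p>0))
reroute {suc n'} {c} {d} {X} (bal₀ , bal) X≥0 d≥0 (suc i) uᵢ>0 oᵢ>0 = record
  { plus = consᴸ u p plus ; minus = consᴸ u p minus
  ; plus-balanced = bal₀ , plus-balanced
  ; minus-balanced = bal₀ , minus-balanced
  ; plus-nonneg = consᴸ-nonneg (rise-nonneg X≥0 zero) (pass-nonneg X≥0 zero) plus-nonneg
  ; minus-nonneg = consᴸ-nonneg (rise-nonneg X≥0 zero) (pass-nonneg X≥0 zero) minus-nonneg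
  ; midpoint = mk≈ᴸ (λ { zero → ½-mix-idem u ; (suc i) → rise-≗ midpoint i })
                    (λ { zero → ½-mix-idem p ; (suc i) → pass-≗ midpoint i }) (exit-≡ midpoint)
  ; moved = moved
  }
  where
  u = rise X zero
  p = pass X zero
  open Rerouting (reroute bal (tailᴸ-nonneg X≥0) (d≥0 ∘ suc) i uᵢ>0 oᵢ>0)

mixᴸ-idem : ∀ l (L : Level n') → L ≈ᴸ mixᴸ l L L
mixᴸ-idem l L = mk≈ᴸ (λ i → sym (mix-idem l (rise L i))) (λ i → sym (mix-idem l (pass L i)))
                     (sym (mix-idem l (exit L)))

-- Flows on G(n,k)

module _ {n' : ℕ} where

  Flow : ℕ → Set
  Flow k = Edge n' k → ℚ

  liftᴱ : ∀ {k} → Edge n' k → Edge n' (suc k)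
  liftᴱ (up i j)    = up i (suc j)
  liftᴱ (right i j) = right i (suc j)
  liftᴱ (toSink j)  = toSink (suc j)

  above : ∀ {k} → Flow (suc k) → Flow k
  above f = f ∘ liftᴱ

  bottom : ∀ {k} → Flow k → Level n'
  bottom {zero}  f = level (λ _ → 0ℚ) (λ i → f (right i zero)) (f (toSink zero))
  bottom {suc k} f = level (λ i → f (up i zero)) (λ i → f (right i zero)) (f (toSink zero))

  stack : ∀ {k} → Level n' → Flow k → Flow (suc k)
  stack L g (up i zero)       = rise L i
  stack L g (up i (suc j))    = g (up i j)
  stack L g (right i zero)    = pass L i
  stack L g (right i (suc j)) = g (right i j)
  stack L g (toSink zero)     = exit L
  stack L g (toSink (suc j))  = g (toSink j)

  ground : Level n' → Flow zero
  ground L (right i zero) = pass L i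
  ground L (toSink zero)  = exit L

  above-stack : ∀ {k} L (g : Flow k) → above (stack L g) ≗ g
  above-stack L g (up i j)    = refl
  above-stack L g (right i j) = refl
  above-stack L g (toSink j)  = refl

  stack-cong : ∀ {k} {L M} {g h : Flow k} → L ≈ᴸ M → g ≗ h → stack L g ≗ stack M h
  stack-cong L≈M g≗h (up i zero)       = rise-≗ L≈M i
  stack-cong L≈M g≗h (up i (suc j))    = g≗h (up i j)
  stack-cong L≈M g≗h (right i zero)    = pass-≗ L≈M i
  stack-cong L≈M g≗h (right i (suc j)) = g≗h (right i j)
  stack-cong L≈M g≗h (toSink zero)     = exit-≡ L≈M
  stack-cong L≈M g≗h (toSink (suc j))  = g≗h (toSink j)

  ground-cong : ∀ {L M} → L ≈ᴸ M → ground L ≗ ground M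
  ground-cong L≈M (right i zero) = pass-≗ L≈M i
  ground-cong L≈M (toSink zero)  = exit-≡ L≈M

  bottom-cong : ∀ {k} {f g : Flow k} → f ≗ g → bottom f ≈ᴸ bottom g
  bottom-cong {zero}  f≗g = mk≈ᴸ (λ _ → refl) (λ i → f≗g (right i zero)) (f≗g (toSink zero))
  bottom-cong {suc k} f≗g =
    mk≈ᴸ (λ i → f≗g (up i zero)) (λ i → f≗g (right i zero)) (f≗g (toSink zero))

  bottom-nonneg : ∀ {k} {f : Flow k} → (∀ e → 0ℚ ≤ f e) → Nonneg (bottom f)
  bottom-nonneg {zero}  f≥0 =
    nonneg (λ _ → ℚ.≤-refl) (λ i → f≥0 (right i zero)) (f≥0 (toSink zero))
  bottom-nonneg {suc k} f≥0 =
    nonneg (λ i → f≥0 (up i zero)) (λ i → f≥0 (right i zero)) (f≥0 (toSink zero))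

  Conserves : ∀ k → Vector ℚ (suc n') → Flow k → Set
  Conserves zero    d f = Balanced 0ℚ d (bottom f)
  Conserves (suc k) d f = Balanced 0ℚ d (bottom f) × Conserves k (rise (bottom f)) (above f)

  Feasible : ∀ k → Vector ℚ (suc n') → Flow k → Set
  Feasible k d f = (∀ e → 0ℚ ≤ f e) × Conserves k d f

  Conserves-cong : ∀ k {d d'} {f g : Flow k} → d ≗ d' → f ≗ g → Conserves k d f → Conserves k d' g
  Conserves-cong zero    d≗ f≗g c = Balanced-cong refl d≗ (bottom-cong f≗g) c
  Conserves-cong (suc k) d≗ f≗g (c₀ , c) =
    Balanced-cong refl d≗ (bottom-cong f≗g) c₀ ,
    Conserves-cong k (rise-≗ (bottom-cong f≗g)) (f≗g ∘ liftᴱ) c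

  Feasible-cong : ∀ k {d d'} {f g : Flow k} → d ≗ d' → f ≗ g → Feasible k d f → Feasible k d' g
  Feasible-cong k d≗ f≗g (f≥0 , c) =
    (λ e → subst (0ℚ ≤_) (f≗g e) (f≥0 e)) , Conserves-cong k d≗ f≗g c

  stack-feasible : ∀ {k d} {L} {g : Flow k} → Balanced 0ℚ d L → Nonneg L → Feasible k (rise L) g →
                   Feasible (suc k) d (stack L g)
  stack-feasible {k} {L = L} {g} bal L≥0 (g≥0 , c) =
    nonneg-stack , bal , Conserves-cong k (λ _ → refl) (sym ∘ above-stack L g) c
    where
    nonneg-stack : ∀ e → 0ℚ ≤ stack L g e
    nonneg-stack (up i zero)       = rise-nonneg L≥0 i
    nonneg-stack (up i (suc j))    = g≥0 (up i j)
    nonneg-stack (right i zero)    = pass-nonneg L≥0 i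
    nonneg-stack (right i (suc j)) = g≥0 (right i j)
    nonneg-stack (toSink zero)     = exit-nonneg L≥0
    nonneg-stack (toSink (suc j))  = g≥0 (toSink j)

  above-feasible : ∀ {k d} {f : Flow (suc k)} → Feasible (suc k) d f →
                   Feasible k (rise (bottom f)) (above f)
  above-feasible (f≥0 , _ , c) = f≥0 ∘ liftᴱ , c

  stack-bottom-above : ∀ {k} (f : Flow (suc k)) → f ≗ stack (bottom f) (above f)
  stack-bottom-above f (up i zero)       = refl
  stack-bottom-above f (up i (suc j))    = refl
  stack-bottom-above f (right i zero)    = refl
  stack-bottom-above f (right i (suc j)) = refl
  stack-bottom-above f (toSink zero)     = refl
  stack-bottom-above f (toSink (suc j))  = refl

  Conserves-total : ∀ k {d} (f : Flow k) → Conserves k d f → sum (λ j → f (toSink j)) ≡ sum d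
  Conserves-total zero {d} f c = begin
    f (toSink zero) + 0ℚ                      ≡⟨ ℚ.+-comm (f (toSink zero)) 0ℚ ⟩
    0ℚ + f (toSink zero)                      ≡⟨ cong (_+ f (toSink zero)) (sum-replicate-zero (suc n')) ⟨
    sum {suc n'} (λ _ → 0ℚ) + f (toSink zero) ≡⟨ Balanced-total c ⟩
    0ℚ + sum d                                ≡⟨ ℚ.+-identityˡ _ ⟩
    sum d                                     ∎
    where open ≡-Reasoning
  Conserves-total (suc k) {d} f (c₀ , c) = begin
    f (toSink zero) + sum (λ j → f (toSink (suc j)))
      ≡⟨ cong (f (toSink zero) +_) (Conserves-total k (above f) c) ⟩
    f (toSink zero) + sum (rise (bottom f)) ≡⟨ ℚ.+-comm (f (toSink zero)) _ ⟩
    sum (rise (bottom f)) + f (toSink zero) ≡⟨ Balanced-total c₀ ⟩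
    0ℚ + sum d                              ≡⟨ ℚ.+-identityˡ _ ⟩
    sum d                                   ∎
    where open ≡-Reasoning

  stack-mix : ∀ {k} l L M (g h : Flow k) →
    stack (mixᴸ l L M) (λ e → mix l (g e) (h e)) ≗ (λ e → mix l (stack L g e) (stack M h e))
  stack-mix l L M g h (up i zero)       = refl
  stack-mix l L M g h (up i (suc j))    = refl
  stack-mix l L M g h (right i zero)    = refl
  stack-mix l L M g h (right i (suc j)) = refl
  stack-mix l L M g h (toSink zero)     = refl
  stack-mix l L M g h (toSink (suc j))  = refl

  ground-mix : ∀ l L M → ground (mixᴸ l L M) ≗ (λ e → mix l (ground L e) (ground M e))
  ground-mix l L M (right i zero) = refl
  ground-mix l L M (toSink zero)  = refl

module _ {n' k : ℕ} where

  sumℚ-allEdges : (F : Edge n' k → ℚ) → sumℚ (List.map F (allEdges n' k)) ≡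
    sum (λ i → sum (λ j → F (up i j))) + (sum (λ i → sum (λ j → F (right i j))) + sum (F ∘ toSink))
  sumℚ-allEdges F = begin
    sumℚ (List.map F (ups ++ rights ++ sinks))
      ≡⟨ cong sumℚ (List.map-++ F ups (rights ++ sinks)) ⟩
    sumℚ (List.map F ups ++ List.map F (rights ++ sinks))
      ≡⟨ sumℚ-++ (List.map F ups) _ ⟩
    sumℚ (List.map F ups) + sumℚ (List.map F (rights ++ sinks))
      ≡⟨ cong (sumℚ (List.map F ups) +_)
              (trans (cong sumℚ (List.map-++ F rights sinks)) (sumℚ-++ (List.map F rights) _)) ⟩
    sumℚ (List.map F ups) + (sumℚ (List.map F rights) + sumℚ (List.map F sinks))
      ≡⟨ cong₂ _+_ (sumℚ-map-family F up)
                   (cong₂ _+_ (sumℚ-map-family F right) (sumℚ-map-map-allFin F toSink)) ⟩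
    sum (λ i → sum (λ j → F (up i j))) + (sum (λ i → sum (λ j → F (right i j))) + sum (F ∘ toSink)) ∎
    where
    open ≡-Reasoning
    ups    = concatMap (λ i → List.map (up i) (allFin k)) (allFin (suc n'))
    rights = concatMap (λ i → List.map (right i) (allFin (suc k))) (allFin n')
    sinks  = List.map toSink (allFin (suc k))

δ-just : ∀ {n' k} (p i : Fin (suc n')) (q j : Fin (suc k)) →
  δ {n'} {k} (just (p , q)) (just (i , j)) ≡ δᶠ p i * δᶠ q j
δ-just p i q j with p Fin.≟ i
... | no _ = sym (ℚ.*-zeroˡ (δᶠ q j))
... | yes refl with q Fin.≟ j
...   | yes refl = refl
...   | no _     = refl

module _ {n' : ℕ} where

  -- layer f j is level j of f (nothing rises from the top level); fromBelow f i j is the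
  -- flow entering (i , j) from below, and feed d f j adds the demand d on level 0.
  layer : ∀ {k} → Flow {n'} k → Fin (suc k) → Level n'
  layer f j = level (λ i → ((λ j′ → f (up i j′)) ∷ʳ 0ℚ) j) (λ i → f (right i j)) (f (toSink j))

  fromBelow : ∀ {k} → Flow {n'} k → Fin (suc n') → Fin (suc k) → ℚ
  fromBelow f i j = (0ℚ ◃ (λ j′ → f (up i j′))) j

  feed : ∀ {k} → Vector ℚ (suc n') → Flow {n'} k → Fin (suc k) → Vector ℚ (suc n')
  feed d f j i = (d i ◃ (λ j′ → f (up i j′))) j

  netFlow-node : ∀ {k} (f : Flow k) i₀ j₀ → netFlow f (just (i₀ , j₀)) ≡
    (rise (layer f j₀) i₀ + onward (layer f j₀) i₀) -
    (fromBelow f i₀ j₀ + (0ℚ ◃ pass (layer f j₀)) i₀)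
  netFlow-node {k} f i₀ j₀ = begin
    netFlow f x
      ≡⟨ sumℚ-allEdges F ⟩
    sum (λ i → sum (λ j → F (up i j))) + (sum (λ i → sum (λ j → F (right i j))) + sum (F ∘ toSink))
      ≡⟨ cong₂ _+_ up-part (cong₂ _+_ right-part sink-part) ⟩
    (U⁺ - U⁻) + ((R⁺ - R⁻) + t₀ * δᶠ (fromℕ n') i₀)
      ≡⟨ solve 5 (λ a b c d e → (a :- b) :+ ((c :- d) :+ e) := (a :+ (c :+ e)) :- (b :+ d)) refl
           U⁺ U⁻ R⁺ R⁻ (t₀ * δᶠ (fromℕ n') i₀) ⟩
    (U⁺ + (R⁺ + t₀ * δᶠ (fromℕ n') i₀)) - (U⁻ + R⁻)
      ≡⟨ cong (λ z → (U⁺ + z) - (U⁻ + R⁻)) (∷ʳ-δᶠ-last rights t₀ i₀) ⟩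
    (U⁺ + onward (layer f j₀) i₀) - (U⁻ + R⁻) ∎
    where
    open ≡-Reasoning
    x = just (i₀ , j₀)
    F : Edge n' k → ℚ
    F e = f e * (δ (tailE e) x - δ (headE e) x)
    ups = λ j → f (up i₀ j)
    rights = λ i → f (right i j₀)
    t₀ = f (toSink j₀)
    U⁺ = (ups ∷ʳ 0ℚ) j₀
    U⁻ = (0ℚ ◃ ups) j₀
    R⁺ = (rights ∷ʳ 0ℚ) i₀
    R⁻ = (0ℚ ◃ rights) i₀

    up-part : sum (λ i → sum (λ j → F (up i j))) ≡ U⁺ - U⁻
    up-part = begin
      sum (λ i → sum (λ j → F (up i j)))
        ≡⟨ sum-cong-≗ (λ i → trans (sum-cong-≗ (factor i))
                                   (sym (*-distribˡ-sum (δᶠ i i₀) (net i)))) ⟩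
      sum (λ i → δᶠ i i₀ * sum (net i))
        ≡⟨ ∑-δᶠ (sum ∘ net) i₀ ⟩
      sum (net i₀)
        ≡⟨ ∑-distrib-- (λ j → ups j * δᶠ (inject₁ j) j₀) (λ j → ups j * δᶠ (suc j) j₀) ⟩
      sum (λ j → ups j * δᶠ (inject₁ j) j₀) - sum (λ j → ups j * δᶠ (suc j) j₀)
        ≡⟨ cong₂ _-_ (∑-δᶠ-inject₁ ups j₀) (∑-δᶠ-suc ups j₀) ⟩
      U⁺ - U⁻ ∎
      where
      net : Fin (suc n') → Fin k → ℚ
      net i j = f (up i j) * δᶠ (inject₁ j) j₀ - f (up i j) * δᶠ (suc j) j₀
      factor : ∀ i j → F (up i j) ≡ δᶠ i i₀ * net i j
      factor i j =
        trans (cong₂ (λ a b → f (up i j) * (a - b))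
                     (δ-just i i₀ (inject₁ j) j₀) (δ-just i i₀ (suc j) j₀))
              (solve 4 (λ a b c d → a :* (b :* c :- b :* d) := b :* (a :* c :- a :* d)) refl
                 (f (up i j)) (δᶠ i i₀) (δᶠ (inject₁ j) j₀) (δᶠ (suc j) j₀))

    right-part : sum (λ i → sum (λ j → F (right i j))) ≡ R⁺ - R⁻
    right-part = begin
      sum (λ i → sum (λ j → F (right i j)))
        ≡⟨ sum-cong-≗ (λ i → trans (sum-cong-≗ (factor i)) (∑-δᶠ (net i) j₀)) ⟩
      sum (λ i → net i j₀)
        ≡⟨ ∑-distrib-- (λ i → rights i * δᶠ (inject₁ i) i₀) (λ i → rights i * δᶠ (suc i) i₀) ⟩
      sum (λ i → rights i * δᶠ (inject₁ i) i₀) - sum (λ i → rights i * δᶠ (suc i) i₀)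
        ≡⟨ cong₂ _-_ (∑-δᶠ-inject₁ rights i₀) (∑-δᶠ-suc rights i₀) ⟩
      R⁺ - R⁻ ∎
      where
      net : Fin n' → Fin (suc k) → ℚ
      net i j = f (right i j) * δᶠ (inject₁ i) i₀ - f (right i j) * δᶠ (suc i) i₀
      factor : ∀ i j → F (right i j) ≡ δᶠ j j₀ * net i j
      factor i j =
        trans (cong₂ (λ a b → f (right i j) * (a - b))
                     (δ-just (inject₁ i) i₀ j j₀) (δ-just (suc i) i₀ j j₀))
              (solve 4 (λ a b c d → a :* (b :* d :- c :* d) := d :* (a :* b :- a :* c)) refl
                 (f (right i j)) (δᶠ (inject₁ i) i₀) (δᶠ (suc i) i₀) (δᶠ j j₀))

    sink-part : sum (F ∘ toSink) ≡ t₀ * δᶠ (fromℕ n') i₀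
    sink-part = trans (sum-cong-≗ factor) (∑-δᶠ (λ j → f (toSink j) * δᶠ (fromℕ n') i₀) j₀)
      where
      factor : ∀ j → F (toSink j) ≡ δᶠ j j₀ * (f (toSink j) * δᶠ (fromℕ n') i₀)
      factor j = trans (cong (λ a → f (toSink j) * (a - 0ℚ)) (δ-just (fromℕ n') i₀ j j₀))
        (solve 3 (λ a b c → a :* (b :* c :- con 0ℚ) := c :* (a :* b)) refl
          (f (toSink j)) (δᶠ (fromℕ n') i₀) (δᶠ j j₀))

  netFlow-sink : ∀ {k} (f : Flow k) → netFlow f nothing ≡ - sum (λ j → f (toSink j))
  netFlow-sink {k} f = begin
    netFlow f nothing
      ≡⟨ sumℚ-allEdges F ⟩
    sum (λ i → sum (λ j → F (up i j))) + (sum (λ i → sum (λ j → F (right i j))) + sum (F ∘ toSink))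
      ≡⟨ cong₂ _+_ (∑-0 _ (λ i → ∑-0 _ (λ j → no-flow (f (up i j)))))
                   (cong (_+ sum (F ∘ toSink))
                         (∑-0 _ (λ i → ∑-0 _ (λ j → no-flow (f (right i j)))))) ⟩
    0ℚ + (0ℚ + sum (F ∘ toSink))
      ≡⟨ trans (ℚ.+-identityˡ _) (ℚ.+-identityˡ _) ⟩
    sum (λ j → f (toSink j) * (0ℚ - 1ℚ))
      ≡⟨ sum-cong-≗ (λ j → solve 1 (λ a → a :* (con 0ℚ :- con 1ℚ) := con 0ℚ :- a) refl
                                  (f (toSink j))) ⟩
    sum (λ j → 0ℚ - f (toSink j))
      ≡⟨ ∑-distrib-- (λ _ → 0ℚ) (λ j → f (toSink j)) ⟩
    sum {suc k} (λ _ → 0ℚ) - sum (λ j → f (toSink j))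
      ≡⟨ cong (_- sum (λ j → f (toSink j))) (sum-replicate-zero (suc k)) ⟩
    0ℚ - sum (λ j → f (toSink j))
      ≡⟨ ℚ.+-identityˡ _ ⟩
    - sum (λ j → f (toSink j)) ∎
    where
    open ≡-Reasoning
    F : Edge n' k → ℚ
    F e = f e * (δ (tailE e) nothing - δ (headE e) nothing)
    no-flow : ∀ a → a * (0ℚ - 0ℚ) ≡ 0ℚ
    no-flow = solve 1 (λ a → a :* (con 0ℚ :- con 0ℚ) := con 0ℚ) refl

  Conserves⇒layers : ∀ k {d} (f : Flow k) → Conserves k d f →
                     ∀ j → Balanced 0ℚ (feed d f j) (layer f j)
  Conserves⇒layers zero    f c        zero    = c
  Conserves⇒layers (suc k) f (c₀ , c) zero    = c₀
  Conserves⇒layers (suc k) f (c₀ , c) (suc j) =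
    Balanced-cong refl (feed-above j) ≈ᴸ-refl (Conserves⇒layers k (above f) c j)
    where
    feed-above : ∀ j i → feed (rise (bottom f)) (above f) j i ≡ f (up i j)
    feed-above zero    i = refl
    feed-above (suc j) i = refl

  layers⇒Conserves : ∀ k {d} (f : Flow k) → (∀ j → Balanced 0ℚ (feed d f j) (layer f j)) →
                     Conserves k d f
  layers⇒Conserves zero    f bal = bal zero
  layers⇒Conserves (suc k) f bal =
    bal zero ,
    layers⇒Conserves k (above f) (λ j → Balanced-cong refl (feed-above j) ≈ᴸ-refl (bal (suc j)))
    where
    feed-above : ∀ j i → f (up i j) ≡ feed (rise (bottom f)) (above f) j i
    feed-above zero    i = refl
    feed-above (suc j) i = refl

demandᵛ : ∀ {n'} → Vec ℕ (suc n') → Vector ℚ (suc n')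
demandᵛ a i = ℕ→ℚ (lookup a i)

sum-demandᵛ : (a : Vec ℕ m) → sum (λ i → ℕ→ℚ (lookup a i)) ≡ ℕ→ℚ (sumℕ (toList a))
sum-demandᵛ []       = refl
sum-demandᵛ (x ∷ a) = trans (cong (ℕ→ℚ x +_) (sum-demandᵛ a)) (sym (ℕ→ℚ-+ x _))

private
  -≡⇒≡+ : ∀ x a b d → x - (a + b) ≡ d → x ≡ b + (a + d)
  -≡⇒≡+ x a b d eq = begin
    x                     ≡⟨ solve 3 (λ x a b → x := (a :+ b) :+ (x :- (a :+ b))) refl x a b ⟩
    (a + b) + (x - (a + b)) ≡⟨ cong ((a + b) +_) eq ⟩
    (a + b) + d           ≡⟨ solve 3 (λ a b d → (a :+ b) :+ d := b :+ (a :+ d)) refl a b d ⟩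
    b + (a + d)           ∎
    where open ≡-Reasoning

  ≡+⇒-≡ : ∀ x a b d → x ≡ b + (a + d) → x - (a + b) ≡ d
  ≡+⇒-≡ x a b d eq = trans (cong (_- (a + b)) eq)
    (solve 3 (λ a b d → (b :+ (a :+ d)) :- (a :+ b) := d) refl a b d)

module _ {n' k : ℕ} (a : Vec ℕ (suc n')) (f : Flow {n'} k) where

  private
    feed-demand : ∀ i j → feed (demandᵛ a) f j i ≡ fromBelow f i j + demand a (just (i , j))
    feed-demand i zero    = sym (ℚ.+-identityˡ _)
    feed-demand i (suc j) = sym (ℚ.+-identityʳ _)

    node⇒column : ∀ i j → netFlow f (just (i , j)) ≡ demand a (just (i , j)) →
      rise (layer f j) i + onward (layer f j) i ≡ (0ℚ ◃ pass (layer f j)) i + feed (demandᵛ a) f j i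
    node⇒column i j eq =
      trans (-≡⇒≡+ _ (fromBelow f i j) ((0ℚ ◃ pass (layer f j)) i) _
               (trans (sym (netFlow-node f i j)) eq))
            (cong ((0ℚ ◃ pass (layer f j)) i +_) (sym (feed-demand i j)))

    column⇒node : ∀ i j →
      rise (layer f j) i + onward (layer f j) i ≡ (0ℚ ◃ pass (layer f j)) i + feed (demandᵛ a) f j i →
      netFlow f (just (i , j)) ≡ demand a (just (i , j))
    column⇒node i j eq = trans (netFlow-node f i j)
      (≡+⇒-≡ _ (fromBelow f i j) ((0ℚ ◃ pass (layer f j)) i) _
         (trans eq (cong ((0ℚ ◃ pass (layer f j)) i +_) (feed-demand i j))))

  inFlowPolytope⇔feasible : InFlowPolytope n' k a f ⇔ Feasible k (demandᵛ a) f
  inFlowPolytope⇔feasible = mk⇔ to from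
    where
    to : InFlowPolytope n' k a f → Feasible k (demandᵛ a) f
    to (f≥0 , eqs) = f≥0 , layers⇒Conserves k f
      (λ j → columns⇒Balanced (λ i → node⇒column i j (eqs (just (i , j)))))
    from : Feasible k (demandᵛ a) f → InFlowPolytope n' k a f
    from (f≥0 , c) = f≥0 , eqs
      where
      eqs : ∀ x → netFlow f x ≡ demand a x
      eqs (just (i , j)) = column⇒node i j (Balanced⇒columns (Conserves⇒layers k f c j) i)
      eqs nothing        = trans (netFlow-sink f) (cong -_ (trans (Conserves-total k f c) (sum-demandᵛ a)))

-- Vertices

Extreme : {E : Set} → ((E → ℚ) → Set) → (E → ℚ) → Set
Extreme S f = S f ×
  (∀ (l : ℚ) g h → 0ℚ < l → l < 1ℚ → S g → S h →
     (∀ e → f e ≡ mix l (g e) (h e)) → g ≗ f × h ≗ f)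

Extreme-cong : ∀ {E : Set} {S S′ : (E → ℚ) → Set} →
  (∀ {f} → S f → S′ f) → (∀ {f} → S′ f → S f) → ∀ {f} → Extreme S f → Extreme S′ f
Extreme-cong S⇒S′ S′⇒S (Sf , ext) =
  S⇒S′ Sf , λ l g h l>0 l<1 S′g S′h f≡ → ext l g h l>0 l<1 (S′⇒S S′g) (S′⇒S S′h) f≡

-- IsVertex n' k a f unfolds to Extreme (InFlowPolytope n' k a) f.
isVertex⇔extreme : ∀ {n' k} (a : Vec ℕ (suc n')) f →
  IsVertex n' k a f ⇔ Extreme (Feasible k (demandᵛ a)) f
isVertex⇔extreme a f = mk⇔ (Extreme-cong to from) (Extreme-cong from to)
  where
  open module E {g} = Equivalence (inFlowPolytope⇔feasible a g)

∷ʳ-map : ∀ {A B : Set} {m} (F : A → B) (g : Vector A m) x → F ∘ (g ∷ʳ x) ≗ (F ∘ g) ∷ʳ F x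
∷ʳ-map {m = zero}  F g x zero    = refl
∷ʳ-map {m = suc m} F g x zero    = refl
∷ʳ-map {m = suc m} F g x (suc i) = ∷ʳ-map F (g ∘ suc) x i

Obeys-transfer : ∀ y {u o u′ o′} → (u ≡ 0ℚ → u′ ≡ 0ℚ) → (o ≡ 0ℚ → o′ ≡ 0ℚ) →
                 Obeys y u o → Obeys y u′ o′
Obeys-transfer zero    u⇒ o⇒ = u⇒
Obeys-transfer (suc _) u⇒ o⇒ = o⇒

module _ {n' : ℕ} where

  outEdge : ∀ {k} → Fin (suc n') → Edge n' k
  outEdge = (λ i → right i zero) ∷ʳ toSink zero

  onward-bottom : ∀ {k} (f : Flow k) i → onward (bottom f) i ≡ f (outEdge i)
  onward-bottom {zero}  f i = sym (∷ʳ-map f (λ i → right i zero) (toSink zero) i)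
  onward-bottom {suc k} f i = sym (∷ʳ-map f (λ i → right i zero) (toSink zero) i)

  Plan : ℕ → Set
  Plan k = Vec (Vec ℕ (suc n')) k

  -- A plan lists, level by level, which columns send their flow up; the top level
  -- sends everything onward.
  flowOf : ∀ {k} → Plan k → Vector ℚ (suc n') → Flow k
  flowOf []      d = ground (route 0ℚ d (replicate _ 0))
  flowOf (j ∷ D) d = stack (route 0ℚ d j) (flowOf D (rise (route 0ℚ d j)))

  flowOf-cong : ∀ {k} (D : Plan k) {d d′} → d ≗ d′ → flowOf D d ≗ flowOf D d′
  flowOf-cong []      d≗ = ground-cong (route-cong _ refl d≗)
  flowOf-cong (j ∷ D) d≗ = stack-cong L≈ (flowOf-cong D (rise-≗ L≈))
    where L≈ = route-cong j refl d≗

  flowOf-mix : ∀ {k} (D : Plan k) l d d′ →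
    flowOf D (λ i → mix l (d i) (d′ i)) ≗ (λ e → mix l (flowOf D d e) (flowOf D d′ e))
  flowOf-mix [] l d d′ e =
    trans (ground-cong (route₀-mix l d d′ _) e) (ground-mix l (route 0ℚ d _) (route 0ℚ d′ _) e)
  flowOf-mix (j ∷ D) l d d′ e =
    trans (stack-cong L≈ (λ e → trans (flowOf-cong D (rise-≗ L≈) e) (flowOf-mix D l _ _ e)) e)
          (stack-mix l (route 0ℚ d j) (route 0ℚ d′ j)
                     (flowOf D (rise (route 0ℚ d j))) (flowOf D (rise (route 0ℚ d′ j))) e)
    where L≈ = route₀-mix l d d′ j

  private
    zeros : Vec ℕ (suc n')
    zeros = replicate _ 0

    routedBy-zeros : ∀ {L} → (∀ i → rise L i ≡ 0ℚ) → RoutedBy zeros L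
    routedBy-zeros {L} rise≡0 i =
      subst (λ y → Obeys y (rise L i) (onward L i)) (sym (Vec.lookup-replicate i 0)) (rise≡0 i)

    route-zeros-rise : ∀ c d i → rise (route c d zeros) i ≡ 0ℚ
    route-zeros-rise c d i =
      subst (λ y → Obeys y (rise (route c d zeros) i) (onward (route c d zeros) i))
        (Vec.lookup-replicate i 0) (route-routedBy c d zeros i)

  flowOf-feasible : ∀ {k} (D : Plan k) {d} → (∀ i → 0ℚ ≤ d i) → Feasible k d (flowOf D d)
  flowOf-feasible [] {d} d≥0 =
    nonneg-ground , Balanced-cong refl (λ _ → refl) L≈ (route-balanced 0ℚ d zeros)
    where
    L≥0 = route-nonneg zeros ℚ.≤-refl d≥0
    L≈ : route 0ℚ d zeros ≈ᴸ bottom (flowOf [] d)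
    L≈ = mk≈ᴸ (route-zeros-rise 0ℚ d) (λ _ → refl) refl
    nonneg-ground : ∀ e → 0ℚ ≤ flowOf [] d e
    nonneg-ground (right i zero) = pass-nonneg L≥0 i
    nonneg-ground (toSink zero)  = exit-nonneg L≥0
  flowOf-feasible (j ∷ D) {d} d≥0 =
    stack-feasible (route-balanced 0ℚ d j) L≥0 (flowOf-feasible D (rise-nonneg L≥0))
    where L≥0 = route-nonneg j ℚ.≤-refl d≥0

  feasible⇒≗flowOf[] : ∀ {d} {g : Flow zero} → Feasible zero d g → g ≗ flowOf [] d
  feasible⇒≗flowOf[] {d} {g} (_ , bal) = go
    where
    L≈ = routedBy⇒≈route zeros bal (routedBy-zeros (λ _ → refl))
    go : ∀ e → g e ≡ flowOf [] d e
    go (right i zero) = pass-≗ L≈ i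
    go (toSink zero)  = exit-≡ L≈

  -- A feasible flow vanishing wherever flowOf D d vanishes is flowOf D d: level by level
  -- it obeys the same routing pattern, and a balanced level is determined by its pattern.
  vanishing⇒≗flowOf : ∀ {k} (D : Plan k) {d} {g : Flow k} → Feasible k d g →
    (∀ e → flowOf D d e ≡ 0ℚ → g e ≡ 0ℚ) → g ≗ flowOf D d
  vanishing⇒≗flowOf [] Fg _ = feasible⇒≗flowOf[] Fg
  vanishing⇒≗flowOf (j ∷ D) {d} {g} (g≥0 , bal , c) vanish e =
    trans (stack-bottom-above g e) (stack-cong L≈ upper e)
    where
    f = flowOf (j ∷ D) d
    rt : RoutedBy j (bottom g)
    rt i = Obeys-transfer (lookup j i) (vanish (up i zero))
      (λ o≡0 → trans (onward-bottom g i) (vanish (outEdge i) (trans (sym (onward-bottom f i)) o≡0)))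
      (route-routedBy 0ℚ d j i)
    L≈ = routedBy⇒≈route j bal rt
    upper : above g ≗ flowOf D (rise (route 0ℚ d j))
    upper = vanishing⇒≗flowOf D (Feasible-cong _ (rise-≗ L≈) (λ _ → refl) (g≥0 ∘ liftᴱ , c))
      (λ e z → vanish (liftᴱ e) (trans (above-stack _ _ e) z))

  flowOf-extreme : ∀ {k} (D : Plan k) {d} → (∀ i → 0ℚ ≤ d i) → Extreme (Feasible k d) (flowOf D d)
  flowOf-extreme D d≥0 = flowOf-feasible D d≥0 , λ l g h l>0 l<1 Fg Fh f≡ →
    vanishing⇒≗flowOf D Fg (λ e z → proj₁ (vanish l>0 l<1 Fg Fh f≡ e z)) ,
    vanishing⇒≗flowOf D Fh (λ e z → proj₂ (vanish l>0 l<1 Fg Fh f≡ e z))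
    where
    vanish : ∀ {k d l} {f g h : Flow k} → 0ℚ < l → l < 1ℚ → Feasible k d g → Feasible k d h →
             (∀ e → f e ≡ mix l (g e) (h e)) → ∀ e → f e ≡ 0ℚ → g e ≡ 0ℚ × h e ≡ 0ℚ
    vanish l>0 l<1 (g≥0 , _) (h≥0 , _) f≡ e z =
      mix≡0⇒≡0 l>0 l<1 (g≥0 e) (h≥0 e) (trans (sym (f≡ e)) z)

pos? : ℚ → Bool
pos? q = does (0ℚ ℚ.<? q)

pos?-true : ∀ {q} → 0ℚ < q → pos? q ≡ true
pos?-true {q} = dec-true (0ℚ ℚ.<? q)

pos?-false : ∀ {q} → ¬ (0ℚ < q) → pos? q ≡ false
pos?-false {q} = dec-false (0ℚ ℚ.<? q)

T-pos? : ∀ {q} → T (pos? q) → 0ℚ < q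
T-pos? {q} = witness (0ℚ ℚ.<? q)
  where
  witness : (p : Dec (0ℚ < q)) → T (does p) → 0ℚ < q
  witness (yes q>0) _ = q>0

pos?-T : ∀ {q} → 0ℚ < q → T (pos? q)
pos?-T q>0 = subst T (sym (pos?-true q>0)) _

pos?-nonNeg-+ : ∀ {c x} → 0ℚ ≤ c → 0ℚ ≤ x → (pos? c ∨ pos? x) ≡ pos? (c + x)
pos?-nonNeg-+ {c} {x} c≥0 x≥0 with 0ℚ ℚ.<? c | 0ℚ ℚ.<? x
... | yes c>0 | _       =
  trans (cong (_∨ pos? x) (pos?-true c>0)) (sym (pos?-true (pos-+-nonNeg c>0 x≥0)))
... | no c≯0  | yes x>0 =
  trans (cong₂ _∨_ (pos?-false c≯0) (pos?-true x>0)) (sym (pos?-true (nonNeg-+-pos c≥0 x>0)))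
... | no c≯0  | no x≯0  =
  trans (cong₂ _∨_ (pos?-false c≯0) (pos?-false x≯0))
        (cong pos? (sym (cong₂ _+_ (nonNeg∧≯0⇒≡0 c≥0 c≯0) (nonNeg∧≯0⇒≡0 x≥0 x≯0))))

χℚ : Vector ℚ m → Vec ℕ m
χℚ d = Vec.tabulate (bit ∘ pos? ∘ d)

binary-χℚ : (d : Vector ℚ m) → Binary (χℚ d)
binary-χℚ {zero}  d = AllV.[]
binary-χℚ {suc m} d = bit≤1 (pos? (d zero)) AllV.∷ binary-χℚ (d ∘ suc)
  where
  bit≤1 : ∀ b → bit b ℕ.≤ 1
  bit≤1 true  = s≤s z≤n
  bit≤1 false = z≤n

χℚ-pos : (d : Vector ℚ m) → ∀ i → T (isPos (lookup (χℚ d) i)) → 0ℚ < d i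
χℚ-pos d i =
  T-pos? ∘ subst T (trans (cong isPos (Vec.lookup∘tabulate (bit ∘ pos? ∘ d) i)) (isPos-bit (pos? (d i))))

RisesAt : Vec ℕ (suc n') → Level n' → Set
RisesAt j L = ∀ i → T (isPos (lookup j i)) → 0ℚ < rise L i

private
  carry-pos : ∀ {c x} → 0ℚ ≤ c → 0ℚ ≤ x → (pos? c ∨ isPos (bit (pos? x))) ≡ pos? (c + x)
  carry-pos {c} {x} c≥0 x≥0 = trans (cong (pos? c ∨_) (isPos-bit (pos? x))) (pos?-nonNeg-+ c≥0 x≥0)

routable⇒rises : ∀ {c d} (j : Vec ℕ (suc n')) → 0ℚ ≤ c → (∀ i → 0ℚ ≤ d i) →
                 T (routable (pos? c) (χℚ d) j) → RisesAt j (route c d j)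
routable⇒rises {n' = zero}   (suc _ ∷ []) c≥0 d≥0 h zero _ =
  T-pos? (subst T (carry-pos c≥0 (d≥0 zero)) (proj₁ (Bool.T-∧ .Equivalence.to h)))
routable⇒rises {n' = suc n'} {d = d} (zero ∷ j) c≥0 d≥0 h (suc i) =
  routable⇒rises j (+-nonNeg c≥0 (d≥0 zero)) (d≥0 ∘ suc)
    (subst (λ o → T (routable o (χℚ (d ∘ suc)) j)) (carry-pos c≥0 (d≥0 zero)) h) i
routable⇒rises {n' = suc n'} (suc _ ∷ j) c≥0 d≥0 h zero _ =
  T-pos? (subst T (carry-pos c≥0 (d≥0 zero)) (proj₁ (Bool.T-∧ .Equivalence.to h)))
routable⇒rises {n' = suc n'} (suc _ ∷ j) c≥0 d≥0 h (suc i) =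
  routable⇒rises j ℚ.≤-refl (d≥0 ∘ suc) (proj₂ (Bool.T-∧ .Equivalence.to h)) i

rises⇒routable : ∀ {c d} (j : Vec ℕ (suc n')) → 0ℚ ≤ c → (∀ i → 0ℚ ≤ d i) →
                 RisesAt j (route c d j) → T (routable (pos? c) (χℚ d) j)
rises⇒routable {n' = zero}   (zero ∷ [])  c≥0 d≥0 r = _
rises⇒routable {n' = zero}   (suc _ ∷ []) c≥0 d≥0 r =
  Bool.T-∧ .Equivalence.from (subst T (sym (carry-pos c≥0 (d≥0 zero))) (pos?-T (r zero _)) , _)
rises⇒routable {n' = suc n'} {d = d} (zero ∷ j)  c≥0 d≥0 r =
  subst (λ o → T (routable o (χℚ (d ∘ suc)) j)) (sym (carry-pos c≥0 (d≥0 zero)))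
    (rises⇒routable j (+-nonNeg c≥0 (d≥0 zero)) (d≥0 ∘ suc) (r ∘ suc))
rises⇒routable {n' = suc n'} (suc _ ∷ j) c≥0 d≥0 r =
  Bool.T-∧ .Equivalence.from (subst T (sym (carry-pos c≥0 (d≥0 zero))) (pos?-T (r zero _)) ,
                              rises⇒routable j ℚ.≤-refl (d≥0 ∘ suc) (r ∘ suc))

route-χℚ : ∀ {d} (j : Vec ℕ (suc n')) → (∀ i → 0ℚ ≤ d i) → Binary j →
           T (routable false (χℚ d) j) → χℚ (rise (route 0ℚ d j)) ≡ j
route-χℚ {d = d} j d≥0 bin h = trans (Vec.tabulate-cong column) (Vec.tabulate∘lookup j)
  where
  rises = routable⇒rises j ℚ.≤-refl d≥0 h
  bit-pos? : ∀ {y u o} → y ℕ.≤ 1 → Obeys y u o → (T (isPos y) → 0ℚ < u) → bit (pos? u) ≡ y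
  bit-pos? z≤n       u≡0 _   = cong (bit ∘ pos?) u≡0
  bit-pos? (s≤s z≤n) _   u>0 = cong bit (pos?-true (u>0 _))
  column : ∀ i → bit (pos? (rise (route 0ℚ d j) i)) ≡ lookup j i
  column i = bit-pos? (AllV.lookup⁺ bin i) (route-routedBy 0ℚ d j i) (rises i)

Valid : ∀ k → Vec ℕ (suc n') → Plan {n'} k → Set
Valid zero    b []      = ⊤
Valid (suc k) b (j ∷ D) = Binary j × T (routable false b j) × Valid k j D

flowOf-injective : ∀ {k} {d : Vector ℚ (suc n')} (D₁ D₂ : Plan {n'} k) → (∀ i → 0ℚ ≤ d i) →
  Valid k (χℚ d) D₁ → Valid k (χℚ d) D₂ → flowOf D₁ d ≗ flowOf D₂ d → D₁ ≡ D₂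
flowOf-injective []        []        d≥0 _ _ _ = refl
flowOf-injective {n'} {suc k} {d} (j₁ ∷ D₁) (j₂ ∷ D₂) d≥0 (b₁ , r₁ , v₁) (b₂ , r₂ , v₂) eq =
  cong₂ _∷_ (trans (sym χ₁) χ₂)
    (flowOf-injective D₁ D₂ (rise-nonneg (route-nonneg j₁ ℚ.≤-refl d≥0))
      (subst (λ b → Valid k b D₁) (sym χ₁) v₁)
      (subst (λ b → Valid k b D₂) (sym χ₂) v₂) upper)
  where
  L₁ = route 0ℚ d j₁
  L₂ = route 0ℚ d j₂
  rise≗ : rise L₁ ≗ rise L₂
  rise≗ i = eq (up i zero)
  χ₁ : χℚ (rise L₁) ≡ j₁
  χ₁ = route-χℚ j₁ d≥0 b₁ r₁
  χ₂ : χℚ (rise L₁) ≡ j₂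
  χ₂ = trans (Vec.tabulate-cong (cong (bit ∘ pos?) ∘ rise≗)) (route-χℚ j₂ d≥0 b₂ r₂)
  upper : flowOf D₁ (rise L₁) ≗ flowOf D₂ (rise L₁)
  upper e = begin
    flowOf D₁ (rise L₁) e        ≡⟨ above-stack L₁ _ e ⟨
    flowOf (j₁ ∷ D₁) d (liftᴱ e) ≡⟨ eq (liftᴱ e) ⟩
    flowOf (j₂ ∷ D₂) d (liftᴱ e) ≡⟨ above-stack L₂ _ e ⟩
    flowOf D₂ (rise L₂) e        ≡⟨ flowOf-cong D₂ (sym ∘ rise≗) e ⟩
    flowOf D₂ (rise L₁) e        ∎
    where open ≡-Reasoning

module _ {n' : ℕ} where

  above-extreme : ∀ {k d} {f : Flow {n'} (suc k)} → Extreme (Feasible (suc k) d) f →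
                  Extreme (Feasible k (rise (bottom f))) (above f)
  above-extreme {k} {d} {f} (Ff@(f≥0 , bal , _) , ext) =
    above-feasible Ff , λ l g h l>0 l<1 Fg Fh above≡ →
      let (g≗ , h≗) = ext l (stack X g) (stack X h) l>0 l<1 (lift Fg) (lift Fh) (f≡ l g h above≡)
      in (λ e → trans (sym (above-stack X g e)) (g≗ (liftᴱ e))) ,
         (λ e → trans (sym (above-stack X h e)) (h≗ (liftᴱ e)))
    where
    X = bottom f
    lift : ∀ {g} → Feasible k (rise X) g → Feasible (suc k) d (stack X g)
    lift = stack-feasible bal (bottom-nonneg f≥0)
    f≡ : ∀ l g h → (∀ e → above f e ≡ mix l (g e) (h e)) →
         ∀ e → f e ≡ mix l (stack X g e) (stack X h e)
    f≡ l g h above≡ e = trans (stack-bottom-above f e)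
      (trans (stack-cong (mixᴸ-idem l X) above≡ e) (stack-mix l X X g h e))

  -- If some column of the bottom level sent flow both up and onward, rerouting ±ε there
  -- and rebuilding the levels above with the same plan would exhibit f as a midpoint.
  extreme-unsplit : ∀ {k d} {f : Flow (suc k)} (D : Plan k) → (∀ i → 0ℚ ≤ d i) →
    Extreme (Feasible (suc k) d) f → above f ≗ flowOf D (rise (bottom f)) →
    ∀ i → 0ℚ < rise (bottom f) i → 0ℚ < onward (bottom f) i → ⊥
  extreme-unsplit {k} {d} {f} D d≥0 ((f≥0 , bal , _) , ext) above≗ i u>0 o>0 =
    moved (agree (up i zero))
    where
    X = bottom f
    open Rerouting (reroute {c = 0ℚ} bal (bottom-nonneg f≥0) d≥0 i u>0 o>0)
    rebuild : Level n' → Flow (suc k)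
    rebuild Q = stack Q (flowOf D (rise Q))
    rebuild-feasible : ∀ {Q} → Balanced 0ℚ d Q → Nonneg Q → Feasible (suc k) d (rebuild Q)
    rebuild-feasible bal Q≥0 = stack-feasible bal Q≥0 (flowOf-feasible D (rise-nonneg Q≥0))
    f≡mid : ∀ e → f e ≡ mix ½ (rebuild plus e) (rebuild minus e)
    f≡mid e = begin
      f e                   ≡⟨ stack-bottom-above f e ⟩
      stack X (above f) e
        ≡⟨ stack-cong midpoint (λ e → trans (above≗ e) (flowOf-cong D (rise-≗ midpoint) e)) e ⟩
      stack (mixᴸ ½ plus minus) (flowOf D (λ i → mix ½ (rise plus i) (rise minus i))) e
        ≡⟨ stack-cong ≈ᴸ-refl (flowOf-mix D ½ (rise plus) (rise minus)) e ⟩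
      stack (mixᴸ ½ plus minus) (λ e → mix ½ (flowOf D (rise plus) e) (flowOf D (rise minus) e)) e
        ≡⟨ stack-mix ½ plus minus (flowOf D (rise plus)) (flowOf D (rise minus)) e ⟩
      mix ½ (rebuild plus e) (rebuild minus e) ∎
      where open ≡-Reasoning
    agree : rebuild plus ≗ f
    agree = proj₁ (ext ½ (rebuild plus) (rebuild minus) 0<½ ½<1
                    (rebuild-feasible plus-balanced plus-nonneg)
                    (rebuild-feasible minus-balanced minus-nonneg) f≡mid)

  unsplit⇒routedBy : ∀ {L : Level n'} → Nonneg L →
    (∀ i → 0ℚ < rise L i → 0ℚ < onward L i → ⊥) → RoutedBy (χℚ (rise L)) L
  unsplit⇒routedBy {L} L≥0 unsplit i =
    subst (λ y → Obeys y (rise L i) (onward L i))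
          (sym (Vec.lookup∘tabulate (bit ∘ pos? ∘ rise L) i)) (obeys (0ℚ ℚ.<? rise L i))
    where
    obeys : (p : Dec (0ℚ < rise L i)) → Obeys (bit (does p)) (rise L i) (onward L i)
    obeys (yes u>0) = nonNeg∧≯0⇒≡0 (onward-nonneg L≥0 i) (unsplit i u>0)
    obeys (no u≯0)  = nonNeg∧≯0⇒≡0 (rise-nonneg L≥0 i) u≯0

  extreme⇒flowOf : ∀ {k d} {f : Flow k} → (∀ i → 0ℚ ≤ d i) → Extreme (Feasible k d) f →
                   Σ[ D ∈ Plan k ] Valid k (χℚ d) D × f ≗ flowOf D d
  extreme⇒flowOf {zero}  d≥0 (Ff , _) = [] , _ , feasible⇒≗flowOf[] Ff
  extreme⇒flowOf {suc k} {d} {f} d≥0 ext@((f≥0 , bal , _) , _) =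
    extend (extreme⇒flowOf (rise-nonneg X≥0) (above-extreme ext))
    where
    X = bottom f
    X≥0 = bottom-nonneg f≥0
    U = rise X
    j = χℚ U
    extend : Σ[ D ∈ Plan k ] Valid k j D × above f ≗ flowOf D U →
             Σ[ D ∈ Plan (suc k) ] Valid (suc k) (χℚ d) D × f ≗ flowOf D d
    extend (D , valid , above≗) = j ∷ D , (binary-χℚ U , routable-j , valid) , f≗
      where
      X≈ : X ≈ᴸ route 0ℚ d j
      X≈ = routedBy⇒≈route j bal (unsplit⇒routedBy X≥0 (extreme-unsplit D d≥0 ext above≗))
      rises : RisesAt j (route 0ℚ d j)
      rises i j≠0 = subst (0ℚ <_) (rise-≗ X≈ i) (χℚ-pos U i j≠0)
      routable-j : T (routable false (χℚ d) j)
      routable-j = rises⇒routable j ℚ.≤-refl d≥0 rises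
      f≗ : f ≗ flowOf (j ∷ D) d
      f≗ e = trans (stack-bottom-above f e)
        (stack-cong X≈ (λ e → trans (above≗ e) (flowOf-cong D (rise-≗ X≈) e)) e)

-- Counting vertices

filterᵇ≡filter : (p : A → Bool) → ∀ xs → filterᵇ p xs ≡ List.filter (T? ∘ p) xs
filterᵇ≡filter p []       = refl
filterᵇ≡filter p (x ∷ xs) with p x
... | true  = cong (x ∷_) (filterᵇ≡filter p xs)
... | false = filterᵇ≡filter p xs

∈-filterᵇ : (p : A → Bool) → ∀ {x} xs → x ∈ filterᵇ p xs ⇔ (x ∈ xs × T (p x))
∈-filterᵇ p xs = mk⇔
  (∈-filter⁻ (T? ∘ p) ∘ subst (_ ∈_) (filterᵇ≡filter p xs))
  (λ (x∈ , px) → subst (_ ∈_) (sym (filterᵇ≡filter p xs)) (∈-filter⁺ (T? ∘ p) x∈ px))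

Unique-filterᵇ : (p : A → Bool) → ∀ {xs} → Unique xs → Unique (filterᵇ p xs)
Unique-filterᵇ p {xs} u = subst Unique (sym (filterᵇ≡filter p xs)) (Unique.filter⁺ (T? ∘ p) u)

Unique-concatMap : (g : A → List B) (tag : B → A) → (∀ {x y} → y ∈ g x → tag y ≡ x) →
  (∀ x → Unique (g x)) → ∀ {xs} → Unique xs → Unique (concatMap g xs)
Unique-concatMap g tag tagged blocks u =
  Unique.concat⁺ (All.map⁺ (All.universal blocks _))
    (AllPairs.map⁺ {f = g}
      (AllPairs.map (λ x≢y {_} (v∈gx , v∈gy) → x≢y (trans (sym (tagged v∈gx)) (tagged v∈gy))) u))

length-concatMap : (g : A → List B) → ∀ xs →
  length (concatMap g xs) ≡ sumℕ (List.map (length ∘ g) xs)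
length-concatMap g []       = refl
length-concatMap g (x ∷ xs) =
  trans (List.length-++ (g x)) (cong (length (g x) ℕ.+_) (length-concatMap g xs))

extendBy01 : Vec ℕ m → List (Vec ℕ (suc m))
extendBy01 w = (0 ∷ w) ∷ (1 ∷ w) ∷ []

∈-binVecs : ∀ {v : Vec ℕ m} → v ∈ binVecs m ⇔ Binary v
∈-binVecs = mk⇔ to from
  where
  to : ∀ {m} {v : Vec ℕ m} → v ∈ binVecs m → Binary v
  to {zero}  {[]} _ = AllV.[]
  to {suc m} v∈ with find (∈-concatMap⁻ extendBy01 {xs = binVecs m} v∈)
  ... | w , w∈ , here refl         = z≤n AllV.∷ to w∈
  ... | w , w∈ , there (here refl) = s≤s z≤n AllV.∷ to w∈
  from : ∀ {m} {v : Vec ℕ m} → Binary v → v ∈ binVecs m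
  from AllV.[]                = here refl
  from (z≤n AllV.∷ bin)     =
    ∈-concatMap⁺ extendBy01 (Any.map (λ { refl → here refl }) (from bin))
  from (s≤s z≤n AllV.∷ bin) =
    ∈-concatMap⁺ extendBy01 (Any.map (λ { refl → there (here refl) }) (from bin))

binVecs-unique : ∀ m → Unique (binVecs m)
binVecs-unique zero    = [] ∷ []
binVecs-unique (suc m) =
  Unique-concatMap extendBy01 Vec.tail tagged (λ _ → ((λ ()) ∷ []) ∷ [] ∷ []) (binVecs-unique m)
  where
  tagged : ∀ {w v} → v ∈ extendBy01 w → Vec.tail v ≡ w
  tagged (here refl)         = refl
  tagged (there (here refl)) = refl

below₁ : Vec ℕ (suc n') → List (Vec ℕ (suc n'))
below₁ {n'} b = filterᵇ (dom₁ b) (binVecs (suc n'))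

below₁-binary : ∀ {b j : Vec ℕ (suc n')} → j ∈ below₁ b → Binary j
below₁-binary {n'} {b} j∈ =
  Equivalence.to ∈-binVecs (proj₁ (Equivalence.to (∈-filterᵇ (dom₁ b) (binVecs (suc n'))) j∈))

plans : ∀ k → Vec ℕ (suc n') → List (Plan {n'} k)
plans zero    b = [] ∷ []
plans (suc k) b = concatMap (λ j → List.map (j ∷_) (plans k j)) (below₁ b)

∈-plans : ∀ k {b : Vec ℕ (suc n')} {D} → Binary b → D ∈ plans k b ⇔ Valid k b D
∈-plans k bin-b = mk⇔ (to k bin-b) (from k bin-b)
  where
  to : ∀ {n'} k {b : Vec ℕ (suc n')} {D} → Binary b → D ∈ plans k b → Valid k b D
  to zero    {D = []} _ _ = _
  to {n'} (suc k) {b} bin-b D∈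
    with find (∈-concatMap⁻ (λ j → List.map (j ∷_) (plans k j)) {xs = below₁ b} D∈)
  ... | j , j∈ , D∈j
    with ∈-map⁻ (j ∷_) D∈j | Equivalence.to (∈-filterᵇ (dom₁ b) (binVecs (suc n'))) j∈
  ...   | D , D∈ , refl | j∈bin , dom₁bj =
    bin-j , subst T (dom₁≡routable b j bin-b bin-j) dom₁bj , to k bin-j D∈
    where bin-j = Equivalence.to ∈-binVecs j∈bin
  from : ∀ {n'} k {b : Vec ℕ (suc n')} {D} → Binary b → Valid k b D → D ∈ plans k b
  from zero    {D = []} _ _ = here refl
  from (suc k) {b} {j ∷ D} bin-b (bin-j , r , v) =
    ∈-concatMap⁺ (λ j → List.map (j ∷_) (plans k j))
      (Any.map (λ { refl → ∈-map⁺ (j ∷_) (from k bin-j v) }) j∈)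
    where
    j∈ = Equivalence.from (∈-filterᵇ (dom₁ b) (binVecs (suc _)))
           (Equivalence.from ∈-binVecs bin-j , subst T (sym (dom₁≡routable b j bin-b bin-j)) r)

plans-unique : ∀ k (b : Vec ℕ (suc n')) → Unique (plans k b)
plans-unique         zero    b = [] ∷ []
plans-unique {n'} (suc k) b =
  Unique-concatMap (λ j → List.map (j ∷_) (plans k j)) Vec.head tagged
    (λ j → Unique.map⁺ (λ eq → cong Vec.tail eq) (plans-unique k j))
    (Unique-filterᵇ (dom₁ b) (binVecs-unique (suc n')))
  where
  tagged : ∀ {j D} → D ∈ List.map (j ∷_) (plans k j) → Vec.head D ≡ j
  tagged D∈ with ∈-map⁻ _ D∈
  ... | _ , _ , refl = refl

length-plans : ∀ k (b : Vec ℕ (suc n')) →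
  length (plans (suc k) b) ≡ sumℕ (List.map (λ j → length (plans k j)) (below₁ b))
length-plans k b = trans (length-concatMap (λ j → List.map (j ∷_) (plans k j)) (below₁ b))
  (cong sumℕ (List.map-cong (λ j → List.length-map (j ∷_) (plans k j)) (below₁ b)))

module _ {A : Set} (_≈_ : A → A → Set) (≈-joint : ∀ {x y z} → x ≈ z → y ≈ z → x ≈ y) where

  private
    remove : ∀ {P : A → Set} {xs} → Any P xs → List A
    remove {xs = _ ∷ xs} (here _)  = xs
    remove {xs = x ∷ _}  (there p) = x ∷ remove p

    length-remove : ∀ {P : A → Set} {xs} (p : Any P xs) → length xs ≡ suc (length (remove p))
    length-remove (here _)  = refl
    length-remove (there p) = cong suc (length-remove p)

    any-remove : ∀ {x y ys} (p : Any (x ≈_) ys) → ¬ x ≈ y → Any (y ≈_) ys →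
                 Any (y ≈_) (remove p)
    any-remove (here x≈z) x≉y (here y≈z) = ⊥-elim (x≉y (≈-joint x≈z y≈z))
    any-remove (here _)   x≉y (there q)  = q
    any-remove (there p)  x≉y (here y≈z) = here y≈z
    any-remove (there p)  x≉y (there q)  = there (any-remove p x≉y q)

  distinct-covered⇒length-≤ : ∀ xs ys → AllPairs (λ x y → ¬ x ≈ y) xs →
    All (λ x → Any (x ≈_) ys) xs → length xs ℕ.≤ length ys
  distinct-covered⇒length-≤ []       ys _                  _                = z≤n
  distinct-covered⇒length-≤ (x ∷ xs) ys (x≉xs ∷ distinct) (x∈ys ∷ covered) =
    subst (suc (length xs) ℕ.≤_) (sym (length-remove x∈ys))
      (s≤s (distinct-covered⇒length-≤ xs (remove x∈ys) distinct
              (All.zipWith (λ (x≉y , y∈ys) → any-remove x∈ys x≉y y∈ys) (x≉xs , covered))))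

AllPairs-map-injectiveOn : ∀ {P : A → Set} {R : B → B → Set} (F : A → B) →
  (∀ {x y} → P x → P y → R (F x) (F y) → x ≡ y) → ∀ {xs} → All P xs → Unique xs →
  AllPairs (λ u v → ¬ R u v) (List.map F xs)
AllPairs-map-injectiveOn F inj []         []          = []
AllPairs-map-injectiveOn F inj (px ∷ pxs) (x∉ ∷ uniq) =
  All.map⁺ (All.zipWith (λ (py , x≢y) r → x≢y (inj px py r)) (pxs , x∉)) ∷
  AllPairs-map-injectiveOn F inj pxs uniq

χℚ-demandᵛ : (a : Vec ℕ m) → χℚ (λ i → ℕ→ℚ (Vec.lookup a i)) ≡ χ a
χℚ-demandᵛ []          = refl
χℚ-demandᵛ (zero ∷ a)  = cong (0 ∷_) (χℚ-demandᵛ a)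
χℚ-demandᵛ (suc x ∷ a) = cong₂ _∷_ (cong bit (pos?-true (ℕ→ℚ-pos x))) (χℚ-demandᵛ a)

HasVertexCount-unique : ∀ {k a N₁ N₂} → HasVertexCount n' k a N₁ → HasVertexCount n' k a N₂ →
                        N₁ ≡ N₂
HasVertexCount-unique (L₁ , v₁ , d₁ , c₁ , refl) (L₂ , v₂ , d₂ , c₂ , refl) = ℕ.≤-antisym
  (distinct-covered⇒length-≤ _≐_ joint L₁ L₂ d₁ (All.map (c₂ _) v₁))
  (distinct-covered⇒length-≤ _≐_ joint L₂ L₁ d₂ (All.map (c₁ _) v₂))
  where
  joint : ∀ {f g h : Edge _ _ → ℚ} → f ≐ h → g ≐ h → f ≐ g
  joint f≐h g≐h e = trans (f≐h e) (sym (g≐h e))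

vertexCount : ∀ k (a : Vec ℕ (suc n')) → HasVertexCount n' k a (length (plans k (χ a)))
vertexCount {n'} k a =
  List.map (λ D → flowOf D d) Ds , vertices , distinct , complete , List.length-map _ Ds
  where
  d = demandᵛ a
  d≥0 : ∀ i → 0ℚ ℚ.≤ d i
  d≥0 i = ℕ→ℚ-nonneg (Vec.lookup a i)
  Ds = plans k (χ a)
  ∈Ds⇔valid : ∀ {D} → D ∈ Ds ⇔ Valid k (χℚ d) D
  ∈Ds⇔valid {D} =
    subst (λ b → D ∈ Ds ⇔ Valid k b D) (sym (χℚ-demandᵛ a)) (∈-plans k (binary-χ a))
  vertices : All (IsVertex n' k a) (List.map (λ D → flowOf D d) Ds)
  vertices = All.map⁺ (All.universal
    (λ D → Equivalence.from (isVertex⇔extreme a _) (flowOf-extreme D d≥0)) Ds)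
  distinct : AllPairs (λ f g → ¬ (f ≐ g)) (List.map (λ D → flowOf D d) Ds)
  distinct = AllPairs-map-injectiveOn (λ D → flowOf D d)
    (λ {D₁} {D₂} v₁ v₂ → flowOf-injective D₁ D₂ d≥0 v₁ v₂)
    (All.tabulate (Equivalence.to ∈Ds⇔valid)) (plans-unique k (χ a))
  complete : ∀ f → IsVertex n' k a f → Any (f ≐_) (List.map (λ D → flowOf D d) Ds)
  complete f f-vertex = from-plan (extreme⇒flowOf d≥0 (Equivalence.to (isVertex⇔extreme a f) f-vertex))
    where
    from-plan : Σ[ D ∈ Plan k ] Valid k (χℚ d) D × f ≗ flowOf D d →
                Any (f ≐_) (List.map (λ D → flowOf D d) Ds)
    from-plan (D , D-valid , f≗) =
      Any.map⁺ (Any.map (λ { refl → f≗ }) (Equivalence.from ∈Ds⇔valid D-valid))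

vertexNumber : ∀ k (a : Vec ℕ (suc n')) → VertexNumber n' k a (length (plans k (χ a)))
vertexNumber zero    a = refl
vertexNumber (suc k) a = vertexCount (suc k) a

vertexNumber-binary : ∀ k {j : Vec ℕ (suc n')} → Binary j → VertexNumber n' k j (length (plans k j))
vertexNumber-binary {n'} k {j} bin =
  subst (λ b → VertexNumber n' k j (length (plans k b))) (χ-binary j bin) (vertexNumber k j)

VertexNumber-unique : ∀ k {a : Vec ℕ (suc n')} {N₁ N₂} →
  VertexNumber n' k a N₁ → VertexNumber n' k a N₂ → N₁ ≡ N₂
VertexNumber-unique zero    N₁≡1 N₂≡1 = trans N₁≡1 (sym N₂≡1)
VertexNumber-unique (suc k) c₁   c₂   = HasVertexCount-unique c₁ c₂

corollary5p17 : (n' m' : ℕ) (a : Vec ℕ (suc n')) →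
    (Σ[ c ∈ (Vec ℕ (suc n') → ℕ) ]
       All (λ j → VertexNumber n' m' j (c j))
           (filterᵇ (λ j → dom₁ (χ a) j) (binVecs (suc n'))))
    ×
    ((c : Vec ℕ (suc n') → ℕ) →
       All (λ j → VertexNumber n' m' j (c j))
           (filterᵇ (λ j → dom₁ (χ a) j) (binVecs (suc n'))) →
       VertexNumber n' (suc m') a
         (sumℕ (map c (filterᵇ (λ j → dom₁ (χ a) j) (binVecs (suc n'))))))
corollary5p17 n' m' a = ((λ j → length (plans m' (χ j))) , All.universal (vertexNumber m') _) , sum-rule
  where
  sum-rule : (c : Vec ℕ (suc n') → ℕ) → All (λ j → VertexNumber n' m' j (c j)) (below₁ (χ a)) →
             VertexNumber n' (suc m') a (sumℕ (map c (below₁ (χ a))))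
  sum-rule c c-counts = subst (VertexNumber n' (suc m') a) count (vertexNumber (suc m') a)
    where
    c≡ : All (λ j → length (plans m' j) ≡ c j) (below₁ (χ a))
    c≡ = All.tabulate λ j∈ →
      VertexNumber-unique m' (vertexNumber-binary m' (below₁-binary j∈)) (All.lookup c-counts j∈)
    count : length (plans (suc m') (χ a)) ≡ sumℕ (map c (below₁ (χ a)))
    count = trans (length-plans m' (χ a)) (cong sumℕ (List.map-cong-local c≡))
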